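{- Let $p$ be an odd prime, $d\ge1$ a divisor of $p-1$, $m=(p-1)/d$, $1\le k\le d$, $e$ a divisor of $\gcd(d,k)$, and $S\in M_e(d,k)$. Then \[ \sum_{S'\in\Gamma_d S}\eta_{S'}=\frac{1}{e}\big[p\,z(S)-m^{k-1}\big], \] where $\Gamma_dS$ is the orbit of $S$ under translation by $\mathbb{Z}/d\mathbb{Z}$.
   Context: Fix a primitive root $g$ mod $p$; $C_s=\{g^{jd+s}:j=0,\dots,m-1\}$; $\zeta$ a primitive complex $p$-th root of unity, $\eta_s=\sum_{x\in C_s}\zeta^x$, $\eta_S=\prod_{s\in S}\eta_s$. Subsets of $\mathbb{Z}/d\mathbb{Z}$ are identified with subsets of $\{0,\dots,d-1\}$. For $S=\{s_1<\dots<s_k\}$, $z(S)$ is the Gauss symbol $\{\{g^{s_1}\},C_{s_2},\dots,C_{s_k}\}$, i.e. the number of $(x_1,\dots,x_k)\in\{g^{s_1}\}\times C_{s_2}\times\cdots\times C_{s_k}$ with $x_1+\cdots+x_k=0$ in $\mathbf{F}_p$. $M_e(d,k)$ is the set of $k$-subsets of $\mathbb{Z}/d\mathbb{Z}$ whose stabilizer under translation has order $e$. -}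

module Defs where

open import Data.Nat as ℕ using (ℕ; zero; suc; _∸_; _^_; _≡ᵇ_)
open import Data.Nat.DivMod using (_mod_; _%_)
open import Data.Integer as ℤ using (ℤ; +_)
open import Data.Fin using (Fin; toℕ)
open import Data.Fin.Subset using (Subset; inside; _∈_)
open import Data.Fin.Subset.Properties using (_∈?_)
open import Data.Vec using (Vec; tabulate; lookup)
open import Data.Vec.Properties using (≡-dec)
open import Data.Bool using (Bool; if_then_else_)
open import Data.Bool.Properties renaming (_≟_ to _≟𝔹_)
open import Data.List as L using (List; []; _∷_; map; allFin; filter; length; deduplicate; concatMap; foldr)
open import Data.Product using (Σ; _×_)
open import Relation.Nullary.Decidable using (does)
open import Relation.Binary.PropositionalEquality using (_≡_; _≢_)
open import Data.Nat.ListAction using () renaming (sum to sumℕ)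

-- Residues: reduction of a natural number modulo n, as an element of
-- Fin n (only usable when Fin n is inhabited, i.e. n ≥ 1).

modF : ∀ {n} → Fin n → ℕ → Fin n
modF {suc n} _ a = a mod suc n

IsPrimitiveRoot : ℕ → ℕ → Set
IsPrimitiveRoot p g =
  Σ (ℕ.NonZero p) λ nz →
    (((g ^ (p ∸ 1)) % p) {{nz}} ≡ 1) ×
    ((j : ℕ) → 1 ℕ.≤ j → j ℕ.< p ∸ 1 → ((g ^ j) % p) {{nz}} ≢ 1)

-- The ring ℤ[ζ], ζ a primitive p-th root of unity (p prime).
-- An element is represented by a coefficient vector c : Fin p → ℤ,
-- standing for  Σ_{i<p} c i ζ^i.  Addition is pointwise, multiplication
-- is convolution modulo p (ζ^p = 1), and two vectors represent the
-- same element of ℤ[ζ] ⊂ ℂ iff their difference is a constant vector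
-- (the kernel of ℤ^p → ℤ[ζ] is spanned by (1,…,1), since
-- 1 + ζ + … + ζ^(p-1) = 0 is the only relation, Φ_p being irreducible).

Cyc : ℕ → Set
Cyc p = Fin p → ℤ

sumℤ : List ℤ → ℤ
sumℤ = foldr ℤ._+_ (+ 0)

module _ {p : ℕ} where

  infixl 6 _⊕_
  infixl 7 _⊛_
  infix 4 _≈_

  _⊕_ : Cyc p → Cyc p → Cyc p
  (f ⊕ g) i = f i ℤ.+ g i

  -- (f g)_i = Σ_j f_j g_{i-j}
  _⊛_ : Cyc p → Cyc p → Cyc p
  (f ⊛ g) i = sumℤ (map (λ j → f j ℤ.* g (modF i (toℕ i ℕ.+ p ∸ toℕ j))) (allFin p))

  𝟘 : Cyc p
  𝟘 _ = + 0

  int : ℤ → Cyc p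
  int n i = if toℕ i ≡ᵇ 0 then n else + 0

  𝟙 : Cyc p
  𝟙 = int (+ 1)

  ζ^ : ℕ → Cyc p
  ζ^ x i = if does (toℕ i ℕ.≟ toℕ (modF i x)) then + 1 else + 0

  _·_ : ℤ → Cyc p → Cyc p
  (n · f) i = n ℤ.* f i

  _≈_ : Cyc p → Cyc p → Set
  f ≈ g = Σ ℤ λ c → (i : Fin p) → f i ≡ g i ℤ.+ c

  ΣC : List (Cyc p) → Cyc p
  ΣC = foldr _⊕_ 𝟘

  ΠC : List (Cyc p) → Cyc p
  ΠC = foldr _⊛_ 𝟙

-- Cyclotomic classes and Gaussian periods.
-- Parameters: prime p, primitive root g, d ∣ p-1, m = (p-1)/d.
-- Elements of F_p are represented by their residues in {0,…,p-1}.

module Periods (p g d m : ℕ) .{{_ : ℕ.NonZero p}} where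

  C : ℕ → List ℕ
  C s = map (λ j → (g ^ (toℕ j ℕ.* d ℕ.+ s)) % p) (allFin m)

  η : ℕ → Cyc p
  η s = ΣC (map ζ^ (C s))

  -- elements of S ⊆ ℤ/dℤ ≅ {0,…,d-1}, listed in increasing order
  elems : Subset d → List ℕ
  elems S = map toℕ (filter (λ i → i ∈? S) (allFin d))

  ηS : Subset d → Cyc p
  ηS S = ΠC (map η (elems S))

  choices : List (List ℕ) → List (List ℕ)
  choices [] = [] ∷ []
  choices (l ∷ ls) = concatMap (λ x → map (x ∷_) (choices ls)) l

  zS : Subset d → ℕ
  zS S with elems S
  ... | [] = 0
  ... | s₁ ∷ rest =
    length (filter (λ xs → (sumℕ xs % p) ℕ.≟ 0)
                   (choices (((g ^ s₁) % p ∷ []) ∷ map C rest)))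

-- S + t = { s + t : s ∈ S },  i.e.  i ∈ S + t  iff  i - t ∈ S
shift : ∀ {d} → Fin d → Subset d → Subset d
shift {d} t S = tabulate λ i → lookup S (modF i (toℕ i ℕ.+ d ∸ toℕ t))

_≟S_ : ∀ {d} (S T : Subset d) → _
_≟S_ = ≡-dec _≟𝔹_

stabOrder : ∀ {d} → Subset d → ℕ
stabOrder {d} S = length (filter (λ t → shift t S ≟S S) (allFin d))

orbit : ∀ {d} → Subset d → List (Subset d)
orbit {d} S = deduplicate _≟S_ (map (λ t → shift t S) (allFin d))

InM : (e d k : ℕ) → Subset d → Set
InM e d k S = (Data.Fin.Subset.∣ S ∣ ≡ k) × (stabOrder S ≡ e)

module Submission where

-- Proof of Proposition 9.  Let p = p'+1 and write elements of ℤ[ζ] as coefficient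
-- vectors Fin p → ℤ (Defs.Cyc), multiplied by convolution; this is the group ring
-- ℤ[ℤ/p], and ℤ[ζ] is its quotient by the constant vectors (Defs._≈_).
--
-- 1. For any c, σ_c : ζ^x ↦ ζ^(cx) is a ring endomorphism of ℤ[ℤ/p] preserving the
--    coefficient sum ε; if c is a unit mod p it fixes the coefficient of ζ^0 and
--    (σ_c f)(c·x) = f(x).
-- 2. The coefficient of ζ^i in a product Π_k Σ_{x∈L_k} ζ^x counts the tuples of
--    L_1 × … × L_k with sum i; so the coefficient of ζ^0 in η_S is m·z(S).
-- 3. With g a primitive root: σ_(g^t) η_s = η_(s+t), η_s depends on s mod d, and
--    η_(S+t) = σ_(g^t) η_S.  Hence V = Σ_{t<d} η_(S+t) is σ_g-invariant, so its
--    coefficients at the nonzero residues (the powers of g) all equal one value N.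
-- 4. V(0) = d·m·z(S) = (p-1)z(S) and ε(V) = d·m^k = (p-1)m^(k-1); comparing with
--    ε(V) = V(0) + (p-1)N gives z(S) + N = m^(k-1).
-- 5. Each translate of S occurs e = |Stab(S)| times among the S+t, so
--    e·Σ_{S'∈Γ_d S} η_(S') = V, which equals p·z(S) - m^(k-1) up to the constant N.

open import Defs using (stabOrder)
open import Data.Nat as ℕ using (ℕ; zero; suc)
open import Data.Nat.Primality using (Prime)
open import Data.Fin.Subset using (Subset; ∣_∣)
open import Relation.Binary.PropositionalEquality using (_≡_; _≢_)
open import Relation.Binary.Definitions using (DecidableEquality)
open import Algebra.Bundles using (CommutativeMonoid)

-- Congruence of naturals
-- is a record so that unification never unfolds it; _⊟_ is exactly the
-- subtraction used by Defs (in _⊛_ and shift), so Defs' definitions compute to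
-- expressions in this module.
module Residues (n' : ℕ) where
  open import Data.Nat using (ℕ; suc; _+_; _*_; _∸_; _%_)
  open import Data.Nat.Properties
    using (+-identityʳ; +-comm; +-assoc; ≤-trans; <⇒≤; m≤n+m; m∸n+n≡m; m+[n∸m]≡n)
  open import Data.Nat.DivMod using (_mod_; m%n<n; m%n%n≡m%n; m<n⇒m%n≡m; n%n≡0; %-distribˡ-+; %-distribˡ-*)
  open import Data.Fin using (Fin; toℕ) renaming (zero to fz)
  open import Data.Fin.Properties using (toℕ-injective; toℕ-fromℕ<; toℕ<n)
  open import Data.Fin.Permutation using (Permutation; permutation)
  open import Relation.Binary.Bundles using (Setoid)
  import Relation.Binary.Reasoning.Setoid as SetoidReasoning
  open import Relation.Binary.PropositionalEquality

  n : ℕ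
  n = suc n'

  R : ℕ → Fin n
  R a = a mod n

  infix 4 _~_
  record _~_ (a b : ℕ) : Set where
    constructor mk~
    field un~ : a % n ≡ b % n
  open _~_ public

  ~-refl : ∀ {a} → a ~ a
  ~-refl = mk~ refl

  ~-sym : ∀ {a b} → a ~ b → b ~ a
  ~-sym (mk~ e) = mk~ (sym e)

  ~-trans : ∀ {a b c} → a ~ b → b ~ c → a ~ c
  ~-trans (mk~ e) (mk~ f) = mk~ (trans e f)

  ≡⇒~ : ∀ {a b} → a ≡ b → a ~ b
  ≡⇒~ refl = ~-refl

  ~-setoid : Setoid _ _
  ~-setoid = record { Carrier = ℕ ; _≈_ = _~_
                    ; isEquivalence = record { refl = ~-refl ; sym = ~-sym ; trans = ~-trans } }

  module ~-Reasoning = SetoidReasoning ~-setoid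

  +~ : ∀ {a b c d} → a ~ b → c ~ d → a + c ~ b + d
  +~ {a} {b} {c} {d} (mk~ e₁) (mk~ e₂) = mk~ (begin
    (a + c) % n               ≡⟨ %-distribˡ-+ a c n ⟩
    (a % n + c % n) % n       ≡⟨ cong₂ (λ x y → (x + y) % n) e₁ e₂ ⟩
    (b % n + d % n) % n       ≡⟨ %-distribˡ-+ b d n ⟨
    (b + d) % n               ∎)
    where open ≡-Reasoning

  *~ : ∀ {a b c d} → a ~ b → c ~ d → a * c ~ b * d
  *~ {a} {b} {c} {d} (mk~ e₁) (mk~ e₂) = mk~ (begin
    (a * c) % n               ≡⟨ %-distribˡ-* a c n ⟩
    (a % n * (c % n)) % n     ≡⟨ cong₂ (λ x y → (x * y) % n) e₁ e₂ ⟩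
    (b % n * (d % n)) % n     ≡⟨ %-distribˡ-* b d n ⟨
    (b * d) % n               ∎)
    where open ≡-Reasoning

  %~ : ∀ a → a % n ~ a
  %~ a = mk~ (m%n%n≡m%n a n)

  +n~ : ∀ a → a + n ~ a
  +n~ a = ~-trans (+~ (~-refl {a}) (mk~ (n%n≡0 n))) (≡⇒~ (+-identityʳ a))

  toℕ-R : ∀ a → toℕ (R a) ≡ a % n
  toℕ-R a = toℕ-fromℕ< (m%n<n a n)

  R~ : ∀ a → toℕ (R a) ~ a
  R~ a = ~-trans (≡⇒~ (toℕ-R a)) (%~ a)

  R%~ : ∀ a → toℕ (R (a % n)) ~ a
  R%~ a = ~-trans (R~ (a % n)) (%~ a)

  R-cong : ∀ {a b} → a ~ b → R a ≡ R b
  R-cong {a} {b} (mk~ e) = toℕ-injective (trans (toℕ-R a) (trans e (sym (toℕ-R b))))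

  R-inj : ∀ {a b} → R a ≡ R b → a ~ b
  R-inj {a} {b} e = mk~ (trans (sym (toℕ-R a)) (trans (cong toℕ e) (toℕ-R b)))

  R-toℕ : ∀ (i : Fin n) → R (toℕ i) ≡ i
  R-toℕ i = toℕ-injective (trans (toℕ-R (toℕ i)) (m<n⇒m%n≡m (toℕ<n i)))

  ~⇒≡ : ∀ {i j : Fin n} → toℕ i ~ toℕ j → i ≡ j
  ~⇒≡ {i} {j} e = trans (sym (R-toℕ i)) (trans (R-cong e) (R-toℕ j))

  -- Addition is cancellable modulo n, using the additive inverse n ∸ c % n.
  +-cancelʳ~ : ∀ {a b c} → a + c ~ b + c → a ~ b
  +-cancelʳ~ {a} {b} {c} e = ~-trans (~-sym (undo a)) (~-trans (+~ e (~-refl {n ∸ c % n})) (undo b))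
    where
    c+negc : c + (n ∸ c % n) ~ 0
    c+negc = ~-trans (+~ (~-sym (%~ c)) ~-refl)
                     (~-trans (≡⇒~ (m+[n∸m]≡n (<⇒≤ (m%n<n c n)))) (mk~ (n%n≡0 n)))
    undo : ∀ x → x + c + (n ∸ c % n) ~ x
    undo x = ~-trans (≡⇒~ (+-assoc x c _)) (~-trans (+~ (~-refl {x}) c+negc) (≡⇒~ (+-identityʳ x)))

  infixl 6 _⊟_ _⊞_
  _⊟_ : Fin n → Fin n → Fin n
  i ⊟ j = R (toℕ i + n ∸ toℕ j)

  _⊞_ : Fin n → Fin n → Fin n
  i ⊞ j = R (toℕ i + toℕ j)

  ⊟-spec : ∀ i j → toℕ (i ⊟ j) + toℕ j ~ toℕ i
  ⊟-spec i j = begin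
    toℕ (i ⊟ j) + toℕ j          ≈⟨ +~ (R~ (toℕ i + n ∸ toℕ j)) ~-refl ⟩
    toℕ i + n ∸ toℕ j + toℕ j    ≡⟨ m∸n+n≡m (≤-trans (<⇒≤ (toℕ<n j)) (m≤n+m n (toℕ i))) ⟩
    toℕ i + n                    ≈⟨ +n~ (toℕ i) ⟩
    toℕ i                        ∎
    where open ~-Reasoning

  ⊟-unique : ∀ {i j x} → toℕ x + toℕ j ~ toℕ i → x ≡ i ⊟ j
  ⊟-unique {i} {j} e = ~⇒≡ (+-cancelʳ~ (~-trans e (~-sym (⊟-spec i j))))

  ⊞-spec : ∀ i j → toℕ (i ⊞ j) ~ toℕ i + toℕ j
  ⊞-spec i j = R~ _

  ⊞-unique : ∀ {i j x} → toℕ x ~ toℕ i + toℕ j → x ≡ i ⊞ j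
  ⊞-unique {i} {j} e = ~⇒≡ (~-trans e (~-sym (⊞-spec i j)))

  ⊟⊞ : ∀ i j → i ⊟ j ⊞ j ≡ i
  ⊟⊞ i j = sym (⊞-unique {i ⊟ j} {j} (~-sym (⊟-spec i j)))

  ⊞⊟ : ∀ i j → i ⊞ j ⊟ j ≡ i
  ⊞⊟ i j = sym (⊟-unique {i ⊞ j} {j} (~-sym (⊞-spec i j)))

  ⊟-invol : ∀ i j → i ⊟ (i ⊟ j) ≡ j
  ⊟-invol i j = sym (⊟-unique {i} {i ⊟ j} (~-trans (≡⇒~ (+-comm (toℕ j) _)) (⊟-spec i j)))

  ⊟-identityʳ : ∀ i → i ⊟ fz ≡ i
  ⊟-identityʳ i = sym (⊟-unique {i} {fz} (≡⇒~ (+-identityʳ (toℕ i))))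

  ⊟-⊞ : ∀ i l u → i ⊟ (u ⊞ l) ≡ i ⊟ l ⊟ u
  ⊟-⊞ i l u = sym (⊟-unique {i} {u ⊞ l} (begin
    toℕ (i ⊟ l ⊟ u) + toℕ (u ⊞ l)          ≈⟨ +~ (~-refl {toℕ (i ⊟ l ⊟ u)}) (⊞-spec u l) ⟩
    toℕ (i ⊟ l ⊟ u) + (toℕ u + toℕ l)      ≡⟨ +-assoc (toℕ (i ⊟ l ⊟ u)) _ _ ⟨
    toℕ (i ⊟ l ⊟ u) + toℕ u + toℕ l        ≈⟨ +~ (⊟-spec (i ⊟ l) u) (~-refl {toℕ l}) ⟩
    toℕ (i ⊟ l) + toℕ l                    ≈⟨ ⊟-spec i l ⟩
    toℕ i                                  ∎))
    where open ~-Reasoning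

  ⊞-⊟ : ∀ i u t → i ⊞ u ⊟ t ≡ i ⊟ (t ⊟ u)
  ⊞-⊟ i u t = ⊟-unique {i} {t ⊟ u} (+-cancelʳ~ {c = toℕ u} (begin
    toℕ (i ⊞ u ⊟ t) + toℕ (t ⊟ u) + toℕ u  ≡⟨ +-assoc (toℕ (i ⊞ u ⊟ t)) _ _ ⟩
    toℕ (i ⊞ u ⊟ t) + (toℕ (t ⊟ u) + toℕ u) ≈⟨ +~ (~-refl {toℕ (i ⊞ u ⊟ t)}) (⊟-spec t u) ⟩
    toℕ (i ⊞ u ⊟ t) + toℕ t                ≈⟨ ⊟-spec (i ⊞ u) t ⟩
    toℕ (i ⊞ u)                            ≈⟨ ⊞-spec i u ⟩
    toℕ i + toℕ u                          ∎))
    where open ~-Reasoning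

  ⊟-cancelʳ : ∀ j u t → j ⊟ u ⊟ (t ⊟ u) ≡ j ⊟ t
  ⊟-cancelʳ j u t = trans (sym (⊞-⊟ (j ⊟ u) u t)) (cong (_⊟ t) (⊟⊞ j u))

  ⊞-perm : Fin n → Permutation n n
  ⊞-perm l = permutation (_⊞ l) (_⊟ l) (λ y → ⊟⊞ y l) (λ y → ⊞⊟ y l)

  ⊟-perm : Fin n → Permutation n n
  ⊟-perm i = permutation (i ⊟_) (i ⊟_) (⊟-invol i) (⊟-invol i)

module Sums where
  open import Data.Nat using (zero; suc; _≡ᵇ_)
  open import Data.Nat.Properties using (≡ᵇ⇒≡; ≡⇒≡ᵇ)
  open import Data.Integer using (ℤ; +_; _+_; _*_)
  open import Data.Integer.Properties
    using (+-*-semiring; +-identityˡ; +-identityʳ; *-identityˡ; *-identityʳ; *-zeroˡ; *-distribʳ-+)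
  open import Data.Fin using (Fin; toℕ) renaming (zero to fz; suc to fs)
  open import Data.Fin.Properties using (toℕ-injective; _≟_)
  open import Data.List using (List; map; allFin; tabulate)
  open import Data.List.Properties using (map-tabulate)
  open import Data.Bool using (true; false; if_then_else_)
  open import Relation.Nullary using (yes; no)
  open import Relation.Binary.PropositionalEquality
  open import Function using (_∘_; id)
  open import Defs using (sumℤ)

  open import Algebra.Properties.Semiring.Sum +-*-semiring public
    using (sum; sum-cong-≗; ∑-distrib-+; ∑-comm; ∑-permute; *-distribˡ-sum; *-distribʳ-sum)

  sumℤ-allFin : ∀ {n} (f : Fin n → ℤ) → sumℤ (map f (allFin n)) ≡ sum f
  sumℤ-allFin {n} f = trans (cong sumℤ (map-tabulate id f)) (sumℤ-tabulate f)
    where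
    sumℤ-tabulate : ∀ {k} (h : Fin k → ℤ) → sumℤ (tabulate h) ≡ sum h
    sumℤ-tabulate {zero} h = refl
    sumℤ-tabulate {suc k} h = cong (λ s → h fz + s) (sumℤ-tabulate (h ∘ fs))

  sum-zero : ∀ n → sum {n} (λ _ → + 0) ≡ + 0
  sum-zero zero = refl
  sum-zero (suc n) = trans (+-identityˡ _) (sum-zero n)

  sum-const : ∀ n (c : ℤ) → sum {n} (λ _ → c) ≡ + n * c
  sum-const zero c = sym (*-zeroˡ c)
  sum-const (suc n) c = begin
    c + sum {n} (λ _ → c)   ≡⟨ cong (λ s → c + s) (sum-const n c) ⟩
    c + + n * c             ≡⟨ cong (_+ + n * c) (*-identityˡ c) ⟨
    + 1 * c + + n * c       ≡⟨ *-distribʳ-+ c (+ 1) (+ n) ⟨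
    + suc n * c             ∎
    where open ≡-Reasoning

  -- δ a b = 1 if a = b and 0 otherwise; Defs' ζ^ x is the column δ (R x).
  δ : ∀ {n} → Fin n → Fin n → ℤ
  δ a b = if toℕ a ≡ᵇ toℕ b then + 1 else + 0

  δ-refl : ∀ {n} (a : Fin n) → δ a a ≡ + 1
  δ-refl a with toℕ a ≡ᵇ toℕ a | ≡⇒≡ᵇ (toℕ a) (toℕ a) refl
  ... | true | _ = refl

  δ-≢ : ∀ {n} {a b : Fin n} → a ≢ b → δ a b ≡ + 0
  δ-≢ {a = a} {b} a≢b with toℕ a ≡ᵇ toℕ b | ≡ᵇ⇒≡ (toℕ a) (toℕ b)
  ... | true  | eq = contradiction (toℕ-injective (eq _)) a≢b
    where open import Relation.Nullary using (contradiction)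
  ... | false | _  = refl

  δ-iff : ∀ {n} {a i b j : Fin n} → (a ≡ i → b ≡ j) → (b ≡ j → a ≡ i) → δ a i ≡ δ b j
  δ-iff {a = a} {i} {b} {j} to from with a ≟ i
  ... | yes refl = trans (δ-refl a) (sym (trans (cong (λ x → δ x j) (to refl)) (δ-refl j)))
  ... | no a≢i   = trans (δ-≢ a≢i) (sym (δ-≢ (a≢i ∘ from)))

  δ-sym : ∀ {n} (a b : Fin n) → δ a b ≡ δ b a
  δ-sym a b = δ-iff {a = a} {b} {b} {a} sym sym

  ∑-δʳ : ∀ {n} (a : Fin n) (f : Fin n → ℤ) → sum (λ j → δ j a * f j) ≡ f a
  ∑-δʳ {suc n} fz f = begin
    + 1 * f fz + sum (λ j → + 0 * f (fs j))   ≡⟨ cong₂ _+_ (*-identityˡ (f fz)) (sum-zero n) ⟩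
    f fz + + 0                              ≡⟨ +-identityʳ (f fz) ⟩
    f fz                                    ∎
    where open ≡-Reasoning
  ∑-δʳ {suc n} (fs a) f = trans (+-identityˡ _) (∑-δʳ a (f ∘ fs))

  ∑-δˡ : ∀ {n} (a : Fin n) (f : Fin n → ℤ) → sum (λ j → δ a j * f j) ≡ f a
  ∑-δˡ a f = trans (sum-cong-≗ (λ j → cong (_* f j) (δ-sym a j))) (∑-δʳ a f)

  ∑-δ : ∀ {n} (a : Fin n) → sum (δ a) ≡ + 1
  ∑-δ a = trans (sum-cong-≗ (λ j → sym (*-identityʳ (δ a j)))) (∑-δˡ a (λ _ → + 1))

-- We work up
-- to pointwise equality _≋_; ℤ[ζ] is the further quotient by constants (Defs._≈_),
-- which is only needed at the very end.
module GroupRing (p' : ℕ) where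
  open Residues p' public
  open Sums
  open import Data.Nat using (zero; suc)
  open import Data.Integer using (ℤ; +_; _+_; _*_)
  import Data.Integer.Properties as ℤP
  open import Data.Fin using (Fin) renaming (zero to fz; suc to fs)
  open import Data.List using (List; []; _∷_; map; allFin; tabulate)
  open import Data.List.Properties using (map-tabulate)
  open import Relation.Binary.PropositionalEquality
  import Relation.Binary.Reasoning.Setoid as SetoidReasoning
  open import Algebra.Bundles using (CommutativeMonoid)
  open import Algebra.Structures.Biased using (isCommutativeMonoidˡ)
  open import Function using (_∘_; id)
  import Algebra.Properties.CommutativeMonoid.Sum as MonoidSum
  open import Defs

  open import Data.Vec.Functional.Relation.Binary.Equality.Setoid (setoid ℤ) public
    using (_≋_; ≋-refl; ≋-reflexive; ≋-sym; ≋-trans; ≋-isEquivalence; ≋-setoid)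

  module ≋-Reasoning = SetoidReasoning (≋-setoid n)

  conv : ∀ (f h : Cyc n) i → (f ⊛ h) i ≡ sum (λ j → f j * h (i ⊟ j))
  conv f h i = sumℤ-allFin (λ j → f j * h (i ⊟ j))

  ζ-cong : ∀ {a b} → a ~ b → ζ^ {n} a ≋ ζ^ b
  ζ-cong e i = cong (δ i) (R-cong e)

  ζ-conv : ∀ x h i → (ζ^ x ⊛ h) i ≡ h (i ⊟ R x)
  ζ-conv x h i = trans (conv (ζ^ x) h i) (∑-δʳ (R x) (λ j → h (i ⊟ j)))

  ⊛-cong : ∀ {f f' h h'} → f ≋ f' → h ≋ h' → f ⊛ h ≋ f' ⊛ h'
  ⊛-cong {f} {f'} {h} {h'} e e' i = begin
    (f ⊛ h) i                       ≡⟨ conv f h i ⟩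
    sum (λ j → f j * h (i ⊟ j))     ≡⟨ sum-cong-≗ (λ j → cong₂ _*_ (e j) (e' (i ⊟ j))) ⟩
    sum (λ j → f' j * h' (i ⊟ j))   ≡⟨ conv f' h' i ⟨
    (f' ⊛ h') i                     ∎
    where open ≡-Reasoning

  ⊛-comm : ∀ f h → f ⊛ h ≋ h ⊛ f
  ⊛-comm f h i = begin
    (f ⊛ h) i                                 ≡⟨ conv f h i ⟩
    sum (λ j → f j * h (i ⊟ j))               ≡⟨ ∑-permute (λ j → f j * h (i ⊟ j)) (⊟-perm i) ⟩
    sum (λ j → f (i ⊟ j) * h (i ⊟ (i ⊟ j)))   ≡⟨ sum-cong-≗ swap ⟩
    sum (λ j → h j * f (i ⊟ j))               ≡⟨ conv h f i ⟨
    (h ⊛ f) i                                 ∎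
    where
    open ≡-Reasoning
    swap : ∀ j → f (i ⊟ j) * h (i ⊟ (i ⊟ j)) ≡ h j * f (i ⊟ j)
    swap j = trans (cong (λ x → f (i ⊟ j) * h x) (⊟-invol i j)) (ℤP.*-comm (f (i ⊟ j)) (h j))

  ⊛-assoc : ∀ f g h → (f ⊛ g) ⊛ h ≋ f ⊛ (g ⊛ h)
  ⊛-assoc f g h i = begin
    ((f ⊛ g) ⊛ h) i                                        ≡⟨ conv (f ⊛ g) h i ⟩
    sum (λ j → (f ⊛ g) j * h (i ⊟ j))                      ≡⟨ sum-cong-≗ expand ⟩
    sum (λ j → sum (λ l → f l * g (j ⊟ l) * h (i ⊟ j)))    ≡⟨ ∑-comm (λ j l → f l * g (j ⊟ l) * h (i ⊟ j)) ⟩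
    sum (λ l → sum (λ j → f l * g (j ⊟ l) * h (i ⊟ j)))    ≡⟨ sum-cong-≗ factor ⟩
    sum (λ l → f l * (g ⊛ h) (i ⊟ l))                      ≡⟨ conv f (g ⊛ h) i ⟨
    (f ⊛ (g ⊛ h)) i                                        ∎
    where
    open ≡-Reasoning
    expand : ∀ j → (f ⊛ g) j * h (i ⊟ j) ≡ sum (λ l → f l * g (j ⊟ l) * h (i ⊟ j))
    expand j = trans (cong (_* h (i ⊟ j)) (conv f g j)) (*-distribʳ-sum (h (i ⊟ j)) (λ l → f l * g (j ⊟ l)))
    -- substituting j = u ⊞ l in the inner sum
    inner : ∀ l → sum (λ j → g (j ⊟ l) * h (i ⊟ j)) ≡ (g ⊛ h) (i ⊟ l)
    inner l = begin
      sum (λ j → g (j ⊟ l) * h (i ⊟ j))                 ≡⟨ ∑-permute (λ j → g (j ⊟ l) * h (i ⊟ j)) (⊞-perm l) ⟩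
      sum (λ u → g (u ⊞ l ⊟ l) * h (i ⊟ (u ⊞ l)))
        ≡⟨ sum-cong-≗ (λ u → cong₂ (λ a b → g a * h b) (⊞⊟ u l) (⊟-⊞ i l u)) ⟩
      sum (λ u → g u * h (i ⊟ l ⊟ u))                   ≡⟨ conv g h (i ⊟ l) ⟨
      (g ⊛ h) (i ⊟ l)                                   ∎
    factor : ∀ l → sum (λ j → f l * g (j ⊟ l) * h (i ⊟ j)) ≡ f l * (g ⊛ h) (i ⊟ l)
    factor l = begin
      sum (λ j → f l * g (j ⊟ l) * h (i ⊟ j))     ≡⟨ sum-cong-≗ (λ j → ℤP.*-assoc (f l) (g (j ⊟ l)) (h (i ⊟ j))) ⟩
      sum (λ j → f l * (g (j ⊟ l) * h (i ⊟ j)))   ≡⟨ *-distribˡ-sum (f l) (λ j → g (j ⊟ l) * h (i ⊟ j)) ⟨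
      f l * sum (λ j → g (j ⊟ l) * h (i ⊟ j))     ≡⟨ cong (f l *_) (inner l) ⟩
      f l * (g ⊛ h) (i ⊟ l)                       ∎

  -- 𝟙 is the monomial ζ^0
  ⊛-identityˡ : ∀ f → 𝟙 ⊛ f ≋ f
  ⊛-identityˡ f i = trans (ζ-conv 0 f i) (cong f (⊟-identityʳ i))

  ⊛-distribʳ : ∀ f g h → (f ⊕ g) ⊛ h ≋ f ⊛ h ⊕ g ⊛ h
  ⊛-distribʳ f g h i = begin
    ((f ⊕ g) ⊛ h) i                                   ≡⟨ conv (f ⊕ g) h i ⟩
    sum (λ j → (f j + g j) * h (i ⊟ j))               ≡⟨ sum-cong-≗ (λ j → ℤP.*-distribʳ-+ (h (i ⊟ j)) (f j) (g j)) ⟩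
    sum (λ j → f j * h (i ⊟ j) + g j * h (i ⊟ j))     ≡⟨ ∑-distrib-+ (λ j → f j * h (i ⊟ j)) (λ j → g j * h (i ⊟ j)) ⟩
    sum (λ j → f j * h (i ⊟ j)) + sum (λ j → g j * h (i ⊟ j))
                                                      ≡⟨ cong₂ _+_ (conv f h i) (conv g h i) ⟨
    (f ⊛ h ⊕ g ⊛ h) i                                 ∎
    where open ≡-Reasoning

  ⊛-zeroˡ : ∀ h → 𝟘 ⊛ h ≋ 𝟘
  ⊛-zeroˡ h i = trans (conv 𝟘 h i) (trans (sum-cong-≗ (λ j → ℤP.*-zeroˡ (h (i ⊟ j)))) (sum-zero n))

  ⊛-commutativeMonoid : CommutativeMonoid _ _
  ⊛-commutativeMonoid = record
    { Carrier = Cyc n ; _≈_ = _≋_ ; _∙_ = _⊛_ ; ε = 𝟙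
    ; isCommutativeMonoid = isCommutativeMonoidˡ (record
      { isSemigroup = record
        { isMagma = record { isEquivalence = ≋-isEquivalence n ; ∙-cong = ⊛-cong }
        ; assoc = ⊛-assoc }
      ; identityˡ = ⊛-identityˡ
      ; comm = ⊛-comm })
    }

  ⊕-commutativeMonoid : CommutativeMonoid _ _
  ⊕-commutativeMonoid = record
    { Carrier = Cyc n ; _≈_ = _≋_ ; _∙_ = _⊕_ ; ε = 𝟘
    ; isCommutativeMonoid = isCommutativeMonoidˡ (record
      { isSemigroup = record
        { isMagma = record { isEquivalence = ≋-isEquivalence n ; ∙-cong = λ e e' i → cong₂ _+_ (e i) (e' i) }
        ; assoc = λ f g h i → ℤP.+-assoc (f i) (g i) (h i) }
      ; identityˡ = λ f i → ℤP.+-identityˡ (f i)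
      ; comm = λ f g i → ℤP.+-comm (f i) (g i) })
    }

  module Π = MonoidSum ⊛-commutativeMonoid
  module Σ = MonoidSum ⊕-commutativeMonoid

  ΣC-allFin : ∀ {k} (F : Fin k → Cyc n) → ΣC (map F (allFin k)) ≡ Σ.sum F
  ΣC-allFin {k} F = trans (cong ΣC (map-tabulate id F)) (ΣC-tabulate F)
    where
    ΣC-tabulate : ∀ {k} (G : Fin k → Cyc n) → ΣC (tabulate G) ≡ Σ.sum G
    ΣC-tabulate {zero} G = refl
    ΣC-tabulate {suc k} G = cong (G fz ⊕_) (ΣC-tabulate (G ∘ fs))

  ΠC-allFin : ∀ {k} (F : Fin k → Cyc n) → ΠC (map F (allFin k)) ≡ Π.sum F
  ΠC-allFin {k} F = trans (cong ΠC (map-tabulate id F)) (ΠC-tabulate F)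
    where
    ΠC-tabulate : ∀ {k} (G : Fin k → Cyc n) → ΠC (tabulate G) ≡ Π.sum G
    ΠC-tabulate {zero} G = refl
    ΠC-tabulate {suc k} G = cong (G fz ⊛_) (ΠC-tabulate (G ∘ fs))

  ΠC-cong : ∀ {A : Set} (xs : List A) {F G : A → Cyc n} → (∀ x → F x ≋ G x) → ΠC (map F xs) ≋ ΠC (map G xs)
  ΠC-cong [] e = ≋-refl
  ΠC-cong (x ∷ xs) {F} e = ⊛-cong {F x} (e x) (ΠC-cong xs e)

  ΣC-at : ∀ (hs : List (Cyc n)) i → ΣC hs i ≡ sumℤ (map (λ h → h i) hs)
  ΣC-at [] i = refl
  ΣC-at (h ∷ hs) i = cong (λ s → h i + s) (ΣC-at hs i)

  Σ-at : ∀ {k} (F : Fin k → Cyc n) i → Σ.sum F i ≡ sum (λ t → F t i)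
  Σ-at {zero} F i = refl
  Σ-at {suc k} F i = cong (λ s → F fz i + s) (Σ-at (F ∘ fs) i)

  ΣCζ-conv : ∀ (L : List ℕ) h i → (ΣC (map ζ^ L) ⊛ h) i ≡ sumℤ (map (λ x → h (i ⊟ R x)) L)
  ΣCζ-conv [] h i = ⊛-zeroˡ h i
  ΣCζ-conv (x ∷ L) h i = trans (⊛-distribʳ (ζ^ x) (ΣC (map ζ^ L)) h i)
                                (cong₂ _+_ (ζ-conv x h i) (ΣCζ-conv L h i))

  -- The augmentation ε(f) = Σ_i f(i) (evaluation at ζ = 1) is a ring homomorphism.
  ε : Cyc n → ℤ
  ε f = sum f

  ε-ζ : ∀ x → ε (ζ^ {n} x) ≡ + 1
  ε-ζ x = trans (sum-cong-≗ (λ i → δ-sym i (R x))) (∑-δ (R x))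

  ε-⊛ : ∀ f h → ε (f ⊛ h) ≡ ε f * ε h
  ε-⊛ f h = begin
    sum (λ i → (f ⊛ h) i)                       ≡⟨ sum-cong-≗ (conv f h) ⟩
    sum (λ i → sum (λ j → f j * h (i ⊟ j)))     ≡⟨ ∑-comm (λ i j → f j * h (i ⊟ j)) ⟩
    sum (λ j → sum (λ i → f j * h (i ⊟ j)))     ≡⟨ sum-cong-≗ (λ j → sym (*-distribˡ-sum (f j) (λ i → h (i ⊟ j)))) ⟩
    sum (λ j → f j * sum (λ i → h (i ⊟ j)))     ≡⟨ sum-cong-≗ (λ j → cong (f j *_) (translate j)) ⟩
    sum (λ j → f j * ε h)                       ≡⟨ *-distribʳ-sum (ε h) f ⟨
    ε f * ε h                                   ∎
    where
    open ≡-Reasoning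
    translate : ∀ j → sum (λ i → h (i ⊟ j)) ≡ ε h
    translate j = trans (∑-permute (λ i → h (i ⊟ j)) (⊞-perm j)) (sum-cong-≗ (λ i → cong h (⊞⊟ i j)))

  ε-Σ : ∀ {k} (F : Fin k → Cyc n) → ε (Σ.sum F) ≡ sum (λ t → ε (F t))
  ε-Σ F = trans (sum-cong-≗ (Σ-at F)) (∑-comm (λ i t → F t i))

-- The Galois action σ_c : ζ ↦ ζ^c on ℤ[ℤ/p]:  (D c f)(i) = Σ_{u : c·u = i} f(u).
module Galois (p' : ℕ) where
  open GroupRing p' public
  open Sums
  open import Data.Nat as ℕ using (zero; suc)
  import Data.Nat.Properties as ℕP
  open import Data.Integer using (+_; _+_; _*_)
  import Data.Integer.Properties as ℤP
  open import Algebra.Properties.CommutativeSemigroup ℤP.*-commutativeSemigroup using (x∙yz≈y∙xz)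
  open import Data.Fin using (Fin; toℕ) renaming (zero to fz; suc to fs)
  open import Data.List using (List; []; _∷_; map)
  open import Relation.Binary.PropositionalEquality
  open import Function using (_∘_)
  open import Defs

  infixl 7 _·R_
  _·R_ : ℕ → Fin n → Fin n
  c ·R u = R (c ℕ.* toℕ u)

  D : ℕ → Cyc n → Cyc n
  D c f i = sum (λ u → δ (c ·R u) i * f u)

  D-cong : ∀ c {f h} → f ≋ h → D c f ≋ D c h
  D-cong c e i = sum-cong-≗ (λ u → cong (δ (c ·R u) i *_) (e u))

  D-⊕ : ∀ c f h → D c (f ⊕ h) ≋ D c f ⊕ D c h
  D-⊕ c f h i = trans (sum-cong-≗ (λ u → ℤP.*-distribˡ-+ (δ (c ·R u) i) (f u) (h u)))
                      (∑-distrib-+ (λ u → δ (c ·R u) i * f u) (λ u → δ (c ·R u) i * h u))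

  D-𝟘 : ∀ c → D c 𝟘 ≋ 𝟘
  D-𝟘 c i = trans (sum-cong-≗ (λ u → ℤP.*-zeroʳ (δ (c ·R u) i))) (sum-zero n)

  D-ζ : ∀ c x → D c (ζ^ x) ≋ ζ^ (c ℕ.* x)
  D-ζ c x i = begin
    sum (λ u → δ (c ·R u) i * δ u (R x))   ≡⟨ sum-cong-≗ (λ u → ℤP.*-comm (δ (c ·R u) i) (δ u (R x))) ⟩
    sum (λ u → δ u (R x) * δ (c ·R u) i)   ≡⟨ ∑-δʳ (R x) (λ u → δ (c ·R u) i) ⟩
    δ (c ·R R x) i                         ≡⟨ δ-sym _ i ⟩
    δ i (c ·R R x)                         ≡⟨ cong (δ i) (R-cong (*~ (~-refl {c}) (R~ x))) ⟩
    δ i (R (c ℕ.* x))                      ∎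
    where open ≡-Reasoning

  D-𝟙 : ∀ c → D c 𝟙 ≋ 𝟙
  D-𝟙 c i = trans (D-ζ c 0 i) (ζ-cong (≡⇒~ (ℕP.*-zeroʳ c)) i)

  -- c·(v + u) = c·v + c·u, as a statement about deltas
  δ-·R-⊞ : ∀ c u v i → δ (c ·R (v ⊞ u)) i ≡ δ (c ·R v) (i ⊟ c ·R u)
  δ-·R-⊞ c u v i = δ-iff {a = c ·R (v ⊞ u)} {b = c ·R v} to from
    where
    split : toℕ (c ·R (v ⊞ u)) ~ toℕ (c ·R v) ℕ.+ toℕ (c ·R u)
    split = begin
      toℕ (c ·R (v ⊞ u))                 ≈⟨ R~ _ ⟩
      c ℕ.* toℕ (v ⊞ u)                  ≈⟨ *~ (~-refl {c}) (⊞-spec v u) ⟩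
      c ℕ.* (toℕ v ℕ.+ toℕ u)            ≡⟨ ℕP.*-distribˡ-+ c (toℕ v) (toℕ u) ⟩
      c ℕ.* toℕ v ℕ.+ c ℕ.* toℕ u        ≈⟨ +~ (R~ (c ℕ.* toℕ v)) (R~ (c ℕ.* toℕ u)) ⟨
      toℕ (c ·R v) ℕ.+ toℕ (c ·R u)      ∎
      where open ~-Reasoning
    to : c ·R (v ⊞ u) ≡ i → c ·R v ≡ i ⊟ c ·R u
    to refl = ⊟-unique {c ·R (v ⊞ u)} {c ·R u} (~-sym split)
    from : c ·R v ≡ i ⊟ c ·R u → c ·R (v ⊞ u) ≡ i
    from e = ~⇒≡ (~-trans split (~-trans (+~ (≡⇒~ (cong toℕ e)) (~-refl {toℕ (c ·R u)})) (⊟-spec i (c ·R u))))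

  D-⊛ : ∀ c f h → D c (f ⊛ h) ≋ D c f ⊛ D c h
  D-⊛ c f h i = begin
    D c (f ⊛ h) i
      ≡⟨ sum-cong-≗ (λ w → trans (cong (δ (c ·R w) i *_) (conv f h w))
                                 (*-distribˡ-sum (δ (c ·R w) i) (λ u → f u * h (w ⊟ u)))) ⟩
    sum (λ w → sum (λ u → δ (c ·R w) i * (f u * h (w ⊟ u))))
      ≡⟨ ∑-comm (λ w u → δ (c ·R w) i * (f u * h (w ⊟ u))) ⟩
    sum (λ u → sum (λ w → δ (c ·R w) i * (f u * h (w ⊟ u))))
      ≡⟨ sum-cong-≗ (λ u → ∑-permute (λ w → δ (c ·R w) i * (f u * h (w ⊟ u))) (⊞-perm u)) ⟩
    sum (λ u → sum (λ v → δ (c ·R (v ⊞ u)) i * (f u * h (v ⊞ u ⊟ u))))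
      ≡⟨ sum-cong-≗ (λ u → sum-cong-≗ (λ v → substitute u v)) ⟩
    sum (λ u → sum (λ v → f u * (δ (c ·R v) (i ⊟ c ·R u) * h v)))
      ≡⟨ sum-cong-≗ (λ u → sym (*-distribˡ-sum (f u) (λ v → δ (c ·R v) (i ⊟ c ·R u) * h v))) ⟩
    sum (λ u → f u * D c h (i ⊟ c ·R u))
      ≡⟨ sum-cong-≗ (λ u → sym (∑-δˡ (c ·R u) (λ j → f u * D c h (i ⊟ j)))) ⟩
    sum (λ u → sum (λ j → δ (c ·R u) j * (f u * D c h (i ⊟ j))))
      ≡⟨ ∑-comm (λ u j → δ (c ·R u) j * (f u * D c h (i ⊟ j))) ⟩
    sum (λ j → sum (λ u → δ (c ·R u) j * (f u * D c h (i ⊟ j))))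
      ≡⟨ sum-cong-≗ (λ j → trans (sum-cong-≗ (λ u → sym (ℤP.*-assoc (δ (c ·R u) j) (f u) (D c h (i ⊟ j)))))
                                 (sym (*-distribʳ-sum (D c h (i ⊟ j)) (λ u → δ (c ·R u) j * f u)))) ⟩
    sum (λ j → D c f j * D c h (i ⊟ j))
      ≡⟨ conv (D c f) (D c h) i ⟨
    (D c f ⊛ D c h) i ∎
    where
    open ≡-Reasoning
    substitute : ∀ u v → δ (c ·R (v ⊞ u)) i * (f u * h (v ⊞ u ⊟ u)) ≡ f u * (δ (c ·R v) (i ⊟ c ·R u) * h v)
    substitute u v = trans (cong₂ (λ a b → a * (f u * h b)) (δ-·R-⊞ c u v i) (⊞⊟ v u))
                           (x∙yz≈y∙xz (δ (c ·R v) (i ⊟ c ·R u)) (f u) (h v))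

  D-Σ : ∀ c {k} (F : Fin k → Cyc n) → D c (Σ.sum F) ≋ Σ.sum (D c ∘ F)
  D-Σ c {zero} F = D-𝟘 c
  D-Σ c {suc k} F = ≋-trans (D-⊕ c (F fz) (Σ.sum (F ∘ fs)))
                            (λ i → cong (λ s → D c (F fz) i + s) (D-Σ c (F ∘ fs) i))

  D-Π : ∀ c {k} (F : Fin k → Cyc n) → D c (Π.sum F) ≋ Π.sum (D c ∘ F)
  D-Π c {zero} F = D-𝟙 c
  D-Π c {suc k} F = ≋-trans (D-⊛ c (F fz) (Π.sum (F ∘ fs))) (⊛-cong {D c (F fz)} ≋-refl (D-Π c (F ∘ fs)))

  D-ΠC : ∀ c (hs : List (Cyc n)) → D c (ΠC hs) ≋ ΠC (map (D c) hs)
  D-ΠC c [] = D-𝟙 c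
  D-ΠC c (h ∷ hs) = ≋-trans (D-⊛ c h (ΠC hs)) (⊛-cong {D c h} ≋-refl (D-ΠC c hs))

  D-∘ : ∀ a b f → D a (D b f) ≋ D (a ℕ.* b) f
  D-∘ a b f i = begin
    sum (λ u → δ (a ·R u) i * sum (λ v → δ (b ·R v) u * f v))
      ≡⟨ sum-cong-≗ (λ u → *-distribˡ-sum (δ (a ·R u) i) (λ v → δ (b ·R v) u * f v)) ⟩
    sum (λ u → sum (λ v → δ (a ·R u) i * (δ (b ·R v) u * f v)))
      ≡⟨ ∑-comm (λ u v → δ (a ·R u) i * (δ (b ·R v) u * f v)) ⟩
    sum (λ v → sum (λ u → δ (a ·R u) i * (δ (b ·R v) u * f v)))
      ≡⟨ sum-cong-≗ (λ v → sum-cong-≗ (λ u → x∙yz≈y∙xz (δ (a ·R u) i) (δ (b ·R v) u) (f v))) ⟩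
    sum (λ v → sum (λ u → δ (b ·R v) u * (δ (a ·R u) i * f v)))
      ≡⟨ sum-cong-≗ (λ v → ∑-δˡ (b ·R v) (λ u → δ (a ·R u) i * f v)) ⟩
    sum (λ v → δ (a ·R (b ·R v)) i * f v)
      ≡⟨ sum-cong-≗ (λ v → cong (λ x → δ x i * f v) (R-cong (assoc v))) ⟩
    sum (λ v → δ ((a ℕ.* b) ·R v) i * f v) ∎
    where
    open ≡-Reasoning
    assoc : ∀ v → a ℕ.* toℕ (b ·R v) ~ a ℕ.* b ℕ.* toℕ v
    assoc v = ~-trans (*~ (~-refl {a}) (R~ (b ℕ.* toℕ v))) (≡⇒~ (sym (ℕP.*-assoc a b (toℕ v))))

  ε-D : ∀ c f → ε (D c f) ≡ ε f
  ε-D c f = begin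
    sum (λ i → sum (λ u → δ (c ·R u) i * f u))    ≡⟨ ∑-comm (λ i u → δ (c ·R u) i * f u) ⟩
    sum (λ u → sum (λ i → δ (c ·R u) i * f u))    ≡⟨ sum-cong-≗ (λ u → *-distribʳ-sum (f u) (δ (c ·R u))) ⟨
    sum (λ u → sum (δ (c ·R u)) * f u)            ≡⟨ sum-cong-≗ (λ u → cong (_* f u) (∑-δ (c ·R u))) ⟩
    sum (λ u → + 1 * f u)                         ≡⟨ sum-cong-≗ (λ u → ℤP.*-identityˡ (f u)) ⟩
    sum f                                         ∎
    where open ≡-Reasoning

  -- For a unit c, u ↦ c·u is injective, so D c f (c·x) = f(x) and D c f 0 = f 0.
  module Unit (c : ℕ) (c-inj : ∀ {a b} → c ℕ.* a ~ c ℕ.* b → a ~ b) where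

    D-at : ∀ f x → D c f (c ·R x) ≡ f x
    D-at f x = trans (sum-cong-≗ (λ u → cong (_* f u) (δ-iff {a = c ·R u} {c ·R x} {u} {x} ·R-inj (cong (c ·R_)))))
                     (∑-δʳ x f)
      where
      ·R-inj : ∀ {u v} → c ·R u ≡ c ·R v → u ≡ v
      ·R-inj e = ~⇒≡ (c-inj (R-inj e))

    D-at0 : ∀ f → D c f fz ≡ f fz
    D-at0 f = trans (cong (D c f) (R-cong (≡⇒~ (sym (ℕP.*-zeroʳ c))))) (D-at f fz)

module Counting where
  open import Data.Nat using (zero; suc)
  open import Data.Nat.Properties using (+-0-commutativeMonoid)
  open import Data.Fin using (Fin) renaming (zero to fz; suc to fs)
  open import Data.Fin.Permutation using (Permutation; _⟨$⟩ʳ_)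
  open import Data.Fin.Subset using (Subset; ∣_∣)
  open import Data.Fin.Subset.Properties using (_∈?_; drop-there)
  open import Data.List using (List; []; _∷_; map; filter; length; allFin; tabulate)
  open import Data.List.Properties using (map-tabulate; filter-≐)
  open import Data.Vec using ([]; _∷_; there)
  open import Data.Bool using (true; false; if_then_else_)
  open import Data.Product using (_,_)
  open import Relation.Nullary using (does)
  open import Relation.Unary using (Pred; Decidable)
  open import Relation.Binary.PropositionalEquality
  open import Function using (_∘_; id)
  open import Level using (0ℓ)
  import Algebra.Properties.CommutativeMonoid.Sum as MonoidSum
  module ℕΣ = MonoidSum +-0-commutativeMonoid

  length-filter-map : ∀ {A B : Set} {P : Pred B 0ℓ} (P? : Decidable P) (f : A → B) (xs : List A) →
    length (filter P? (map f xs)) ≡ length (filter (P? ∘ f) xs)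
  length-filter-map P? f [] = refl
  length-filter-map P? f (x ∷ xs) with does (P? (f x))
  ... | true  = cong suc (length-filter-map P? f xs)
  ... | false = length-filter-map P? f xs

  length-filter-tail : ∀ {k} {P : Pred (Fin (suc k)) 0ℓ} (P? : Decidable P) →
    length (filter P? (tabulate fs)) ≡ length (filter (P? ∘ fs) (allFin k))
  length-filter-tail {k} P? = trans (cong (length ∘ filter P?) (sym (map-tabulate id fs))) (length-filter-map P? fs (allFin k))

  count≡Σ : ∀ {k} {P : Pred (Fin k) 0ℓ} (P? : Decidable P) →
    length (filter P? (allFin k)) ≡ ℕΣ.sum (λ i → if does (P? i) then 1 else 0)
  count≡Σ {zero} P? = refl
  count≡Σ {suc k} P? with does (P? fz)
  ... | true  = cong suc (trans (length-filter-tail P?) (count≡Σ (P? ∘ fs)))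
  ... | false = trans (length-filter-tail P?) (count≡Σ (P? ∘ fs))

  count-permute : ∀ {k} {P : Pred (Fin k) 0ℓ} (P? : Decidable P) (π : Permutation k k) →
    length (filter (P? ∘ (π ⟨$⟩ʳ_)) (allFin k)) ≡ length (filter P? (allFin k))
  count-permute P? π = trans (count≡Σ (P? ∘ (π ⟨$⟩ʳ_)))
    (trans (sym (ℕΣ.∑-permute (λ i → if does (P? i) then 1 else 0) π)) (sym (count≡Σ P?)))

  length-elements-tail : ∀ {k} b (T : Subset k) →
    length (filter (_∈? (b ∷ T)) (tabulate fs)) ≡ length (filter (_∈? T) (allFin k))
  length-elements-tail {k} b T =
    trans (length-filter-tail (_∈? (b ∷ T))) (cong length (filter-≐ _ _ (drop-there , there) (allFin k)))

  length-elements : ∀ {k} (T : Subset k) → length (filter (_∈? T) (allFin k)) ≡ ∣ T ∣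
  length-elements {zero} [] = refl
  length-elements (true ∷ T) = cong suc (trans (length-elements-tail true T) (length-elements T))
  length-elements (false ∷ T) = trans (length-elements-tail false T) (length-elements T)

-- Counting solutions: the coefficient of ζ^i in Π_k (Σ_{x ∈ L_k} ζ^x) is the
-- number of tuples in L_1 × … × L_k whose sum is i modulo p.  (g, d, m are only
-- the parameters under which Defs.Periods defines the tuple enumeration.)
module TupleCount (p' g d m : ℕ) where
  open GroupRing p'
  open Counting using (length-filter-map)
  open import Data.Nat as ℕ using (suc; _%_)
  import Data.Nat.Properties as ℕP
  open import Data.Nat.DivMod using (m<n⇒m%n≡m)
  open import Data.Nat.ListAction using () renaming (sum to sumℕ)
  open import Data.Integer using (+_; _+_)
  open import Data.Integer.Properties using (pos-+)
  open import Data.Fin using (Fin; toℕ) renaming (zero to fz; suc to fs)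
  open import Data.Fin.Properties using (toℕ<n)
  open import Data.List using (List; []; _∷_; _++_; map; filter; length; concatMap)
  open import Data.List.Properties using (filter-++; length-++; filter-≐; map-cong)
  open import Data.Product using (_,_)
  open import Relation.Unary using (Pred; Decidable)
  open import Relation.Binary.PropositionalEquality
  open import Level using (0ℓ)
  open import Defs
  open Periods n g d m using (choices)

  length-filter-concatMap : ∀ {A : Set} {Q : Pred A 0ℓ} (Q? : Decidable Q) (F : ℕ → List A) (L : List ℕ) →
    + length (filter Q? (concatMap F L)) ≡ sumℤ (map (λ x → + length (filter Q? (F x))) L)
  length-filter-concatMap Q? F [] = refl
  length-filter-concatMap Q? F (x ∷ L) = begin
    + length (filter Q? (F x ++ concatMap F L))
      ≡⟨ cong (λ z → + length z) (filter-++ Q? (F x) (concatMap F L)) ⟩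
    + length (filter Q? (F x) ++ filter Q? (concatMap F L))
      ≡⟨ cong +_ (length-++ (filter Q? (F x))) ⟩
    + (length (filter Q? (F x)) ℕ.+ length (filter Q? (concatMap F L)))
      ≡⟨ pos-+ (length (filter Q? (F x))) _ ⟩
    + length (filter Q? (F x)) + + length (filter Q? (concatMap F L))
      ≡⟨ cong (λ z → + length (filter Q? (F x)) + z) (length-filter-concatMap Q? F L) ⟩
    sumℤ (map (λ x → + length (filter Q? (F x))) (x ∷ L)) ∎
    where open ≡-Reasoning

  solutions : List (List ℕ) → Cyc n
  solutions Ls i = + length (filter (λ xs → (sumℕ xs % n) ℕ.≟ toℕ i) (choices Ls))

  shift-sum : ∀ x i s → ((x ℕ.+ s) % n ≡ toℕ i) → (s % n ≡ toℕ (i ⊟ R x))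
  shift-sum x i s e = trans (sym (toℕ-R s)) (cong toℕ (⊟-unique {i} {R x} {R s} (begin
    toℕ (R s) ℕ.+ toℕ (R x)   ≈⟨ +~ (R~ s) (R~ x) ⟩
    s ℕ.+ x                   ≡⟨ ℕP.+-comm s x ⟩
    x ℕ.+ s                   ≈⟨ mk~ (trans e (sym (m<n⇒m%n≡m (toℕ<n i)))) ⟩
    toℕ i                     ∎)))
    where open ~-Reasoning

  unshift-sum : ∀ x i s → (s % n ≡ toℕ (i ⊟ R x)) → ((x ℕ.+ s) % n ≡ toℕ i)
  unshift-sum x i s e = trans (un~ (begin
    x ℕ.+ s                       ≈⟨ +~ (~-sym (R~ x)) (~-sym (%~ s)) ⟩
    toℕ (R x) ℕ.+ s % n           ≡⟨ cong (toℕ (R x) ℕ.+_) e ⟩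
    toℕ (R x) ℕ.+ toℕ (i ⊟ R x)   ≡⟨ ℕP.+-comm (toℕ (R x)) _ ⟩
    toℕ (i ⊟ R x) ℕ.+ toℕ (R x)   ≈⟨ ⊟-spec i (R x) ⟩
    toℕ i                         ∎)) (m<n⇒m%n≡m (toℕ<n i))
    where open ~-Reasoning

  solutions-∷ : ∀ L Ls i → solutions (L ∷ Ls) i ≡ sumℤ (map (λ x → solutions Ls (i ⊟ R x)) L)
  solutions-∷ L Ls i = trans (length-filter-concatMap sum≟i (λ x → map (x ∷_) (choices Ls)) L)
                             (cong sumℤ (map-cong (λ x → cong +_ (fix-first x)) L))
    where
    sum≟i = λ (xs : List ℕ) → (sumℕ xs % n) ℕ.≟ toℕ i
    fix-first : ∀ x → length (filter sum≟i (map (x ∷_) (choices Ls)))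
                      ≡ length (filter (λ xs → (sumℕ xs % n) ℕ.≟ toℕ (i ⊟ R x)) (choices Ls))
    fix-first x = trans (length-filter-map sum≟i (x ∷_) (choices Ls))
      (cong length (filter-≐ _ _ ((λ {s} → shift-sum x i (sumℕ s)) , (λ {s} → unshift-sum x i (sumℕ s))) (choices Ls)))

  ΠΣζ≋solutions : ∀ Ls → ΠC (map (λ L → ΣC (map ζ^ L)) Ls) ≋ solutions Ls
  ΠΣζ≋solutions [] fz = refl
  ΠΣζ≋solutions [] (fs i) = refl
  ΠΣζ≋solutions (L ∷ Ls) i = begin
    (ΣC (map ζ^ L) ⊛ ΠC (map (λ L → ΣC (map ζ^ L)) Ls)) i  ≡⟨ ⊛-cong {ΣC (map ζ^ L)} ≋-refl (ΠΣζ≋solutions Ls) i ⟩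
    (ΣC (map ζ^ L) ⊛ solutions Ls) i                        ≡⟨ ΣCζ-conv L (solutions Ls) i ⟩
    sumℤ (map (λ x → solutions Ls (i ⊟ R x)) L)             ≡⟨ solutions-∷ L Ls i ⟨
    solutions (L ∷ Ls) i                                    ∎
    where open ≡-Reasoning

-- Modulo a prime, multiplication by a non-multiple of p is injective (Euclid's lemma).
module PrimeModulus (p' : ℕ) (pr : Prime (suc p')) where
  open Residues p'
  open import Data.Nat using (zero; suc; _+_; _*_; _∸_; _^_; _%_; _≤_; _<_)
  open import Data.Nat.Properties
    using (≤-total; ≤-antisym; ≤-<-trans; m∸n≤m; m∸n≡0⇒m≤n; m+[n∸m]≡n; *-monoʳ-≤; *-distribˡ-∸; +-comm)
  open import Data.Nat.DivMod using (m<n⇒m%n≡m; m%n<n)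
  open import Data.Nat.Divisibility using (_∣_; ∣1⇒≡1; m%n≡0⇒n∣m; n∣m⇒m%n≡0)
  open import Data.Nat.Primality using (euclidsLemma; prime⇒nonTrivial)
  open import Data.Nat.Base using (nonTrivial⇒≢1)
  open import Data.Sum using ([_,_]; [_,_]′)
  open import Relation.Nullary using (¬_; contradiction)
  open import Relation.Binary.PropositionalEquality
  open import Function using (id)

  n∤1 : ¬ (n ∣ 1)
  n∤1 n∣1 = nonTrivial⇒≢1 {{prime⇒nonTrivial pr}} (∣1⇒≡1 n∣1)

  ∣∧<⇒≡0 : ∀ {k} → n ∣ k → k < n → k ≡ 0
  ∣∧<⇒≡0 {k} n∣k k<n = trans (sym (m<n⇒m%n≡m k<n)) (n∣m⇒m%n≡0 k n n∣k)

  ~⇒∣∸ : ∀ {a b} → a ≤ b → a ~ b → n ∣ b ∸ a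
  ~⇒∣∸ {a} {b} a≤b a~b = m%n≡0⇒n∣m (b ∸ a) n (un~ (+-cancelʳ~ {c = a} (begin
    b ∸ a + a     ≡⟨ +-comm (b ∸ a) a ⟩
    a + (b ∸ a)   ≡⟨ m+[n∸m]≡n a≤b ⟩
    b             ≈⟨ a~b ⟨
    a             ∎)))
    where open ~-Reasoning

  *-cancel-≤ : ∀ c → ¬ (n ∣ c) → ∀ {u v} → u ≤ v → v < n → c * u ~ c * v → u ≡ v
  *-cancel-≤ c n∤c {u} {v} u≤v v<n cu~cv = ≤-antisym u≤v (m∸n≡0⇒m≤n v∸u≡0)
    where
    n∣c[v∸u] : n ∣ c * (v ∸ u)
    n∣c[v∸u] = subst (n ∣_) (sym (*-distribˡ-∸ c v u)) (~⇒∣∸ (*-monoʳ-≤ c u≤v) cu~cv)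
    v∸u≡0 : v ∸ u ≡ 0
    v∸u≡0 = ∣∧<⇒≡0 ([ (λ n∣c → contradiction n∣c n∤c) , id ] (euclidsLemma c (v ∸ u) pr n∣c[v∸u]))
                   (≤-<-trans (m∸n≤m v u) v<n)

  *-cancelˡ~ : ∀ c → ¬ (n ∣ c) → ∀ {a b} → c * a ~ c * b → a ~ b
  *-cancelˡ~ c n∤c {a} {b} ca~cb = mk~ ([ a≤b-case , b≤a-case ]′ (≤-total (a % n) (b % n)))
    where
    reduced : c * (a % n) ~ c * (b % n)
    reduced = ~-trans (*~ (~-refl {c}) (%~ a)) (~-trans ca~cb (*~ (~-refl {c}) (~-sym (%~ b))))
    a≤b-case : a % n ≤ b % n → a % n ≡ b % n
    a≤b-case a≤b = *-cancel-≤ c n∤c a≤b (m%n<n b n) reduced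
    b≤a-case : b % n ≤ a % n → a % n ≡ b % n
    b≤a-case b≤a = sym (*-cancel-≤ c n∤c b≤a (m%n<n a n) (~-sym reduced))

  n∤^ : ∀ {c} → ¬ (n ∣ c) → ∀ j → ¬ (n ∣ c ^ j)
  n∤^ n∤c zero = n∤1
  n∤^ {c} n∤c (suc j) n∣c^suc = [ n∤c , n∤^ n∤c j ] (euclidsLemma c (c ^ j) pr n∣c^suc)

module FinPigeonhole where
  open import Data.Fin using (Fin; toℕ; punchOut) renaming (_<_ to _<ᶠ_)
  open import Data.Fin.Properties using (_≟_; any?; pigeonhole; punchOut-injective)
  open import Data.Nat.Properties using (n<1+n; <-irrefl)
  open import Data.Product using (∃; ∃₂; _×_; _,_)
  open import Relation.Nullary using (¬_; yes; no; contradiction)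
  open import Relation.Binary.PropositionalEquality

  injective⇒surjective : ∀ {k} (f : Fin k → Fin k) → (∀ {a b} → f a ≡ f b → a ≡ b) → ∀ y → ∃ λ x → f x ≡ y
  injective⇒surjective {suc q} f f-inj y with any? (λ x → f x ≟ y)
  ... | yes hit  = hit
  ... | no miss = contradiction (pigeonhole (n<1+n q) squeeze) no-collision
    where
    avoids : ∀ x → y ≢ f x
    avoids x y≡fx = miss (x , sym y≡fx)
    -- f misses y, so it factors through the q-element set Fin (suc q) ∖ {y}
    squeeze : Fin (suc q) → Fin q
    squeeze x = punchOut (avoids x)
    no-collision : ¬ (∃₂ λ a b → a <ᶠ b × squeeze a ≡ squeeze b)
    no-collision (a , b , a<b , e) =
      <-irrefl (cong toℕ (f-inj (punchOut-injective (avoids a) (avoids b) e))) a<b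

module PrimitiveRoot (p' : ℕ) (pr : Prime (suc p')) (g : ℕ)
                     (g^p'≡1 : (g ℕ.^ p') ℕ.% suc p' ≡ 1)
                     (order : ∀ j → 1 ℕ.≤ j → j ℕ.< p' → (g ℕ.^ j) ℕ.% suc p' ≢ 1) where
  open Residues p'
  open PrimeModulus p' pr
  open FinPigeonhole
  open import Data.Nat using (zero; suc; _+_; _*_; _∸_; _^_; _%_; _≤_; _<_; z≤n; s≤s)
  open import Data.Nat.Properties
    using (≤-total; ≤-antisym; ≤-<-trans; m∸n≤m; m∸n≡0⇒m≤n; m+[n∸m]≡n; *-identityʳ; ^-distribˡ-+-*)
  open import Data.Nat.DivMod using (m<n⇒m%n≡m)
  open import Data.Nat.Divisibility using (_∣_; ∣-trans; m∣m*n; n∣m⇒m%n≡0; m%n≡0⇒n∣m)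
  open import Data.Nat.Primality using (prime⇒nonTrivial)
  open import Data.Nat.Base using (s≤s⁻¹; nonTrivial⇒n>1)
  open import Data.Fin using (Fin; toℕ; punchOut; punchIn) renaming (zero to fz; suc to fs)
  open import Data.Fin.Properties using (toℕ-injective; toℕ<n; punchOut-injective; punchIn-punchOut)
  open import Data.Product using (∃; _,_)
  open import Data.Sum using (inj₁; inj₂)
  open import Relation.Nullary using (¬_; contradiction)
  open import Relation.Binary.PropositionalEquality

  1≤p' : 1 ≤ p'
  1≤p' = s≤s⁻¹ (nonTrivial⇒n>1 n {{prime⇒nonTrivial pr}})

  g∤ : ¬ (n ∣ g)
  g∤ n∣g = 0≢1 (trans (sym (n∣m⇒m%n≡0 (g ^ p') n (∣-trans n∣g (∣^ 1≤p')))) g^p'≡1)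
    where
    0≢1 : 0 ≢ 1
    0≢1 ()
    ∣^ : ∀ {j} → 1 ≤ j → g ∣ g ^ j
    ∣^ {suc j} _ = m∣m*n (g ^ j)

  g^p'~1 : g ^ p' ~ 1
  g^p'~1 = mk~ (trans g^p'≡1 (sym (m<n⇒m%n≡m (s≤s 1≤p'))))

  g^-unit : ∀ t {a b} → g ^ t * a ~ g ^ t * b → a ~ b
  g^-unit t = *-cancelˡ~ (g ^ t) (n∤^ g∤ t)

  pow-inj-≤ : ∀ {i j} → i ≤ j → j < p' → g ^ i ~ g ^ j → i ≡ j
  pow-inj-≤ {i} {j} i≤j j<p' g^i~g^j with j ∸ i in j∸i≡
  ... | zero  = ≤-antisym i≤j (m∸n≡0⇒m≤n j∸i≡)
  ... | suc k = contradiction (trans (un~ g^[j∸i]~1) (m<n⇒m%n≡m (s≤s 1≤p')))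
                              (order (suc k) (s≤s z≤n) (≤-<-trans (subst (_≤ j) j∸i≡ (m∸n≤m j i)) j<p'))
    where
    g^[j∸i]~1 : g ^ suc k ~ 1
    g^[j∸i]~1 = subst (λ t → g ^ t ~ 1) j∸i≡ (g^-unit i (begin
      g ^ i * g ^ (j ∸ i)   ≡⟨ ^-distribˡ-+-* g i (j ∸ i) ⟨
      g ^ (i + (j ∸ i))     ≡⟨ cong (g ^_) (m+[n∸m]≡n i≤j) ⟩
      g ^ j                 ≈⟨ g^i~g^j ⟨
      g ^ i                 ≡⟨ *-identityʳ (g ^ i) ⟨
      g ^ i * 1             ∎))
      where open ~-Reasoning

  pow-inj : ∀ {i j} → i < p' → j < p' → g ^ i ~ g ^ j → i ≡ j
  pow-inj {i} {j} i<p' j<p' e with ≤-total i j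
  ... | inj₁ i≤j = pow-inj-≤ i≤j j<p' e
  ... | inj₂ j≤i = sym (pow-inj-≤ j≤i i<p' (~-sym e))

  g^≢0 : ∀ j → fz ≢ R (g ^ j)
  g^≢0 j 0≡ = n∤^ g∤ j (m%n≡0⇒n∣m (g ^ j) n (trans (sym (toℕ-R (g ^ j))) (sym (cong toℕ 0≡))))

  -- j ↦ g^j, viewed as a map Fin (p-1) → Fin p ∖ {0} ≅ Fin (p-1); it is injective, hence onto
  power : Fin p' → Fin p'
  power j = punchOut (g^≢0 (toℕ j))

  power-inj : ∀ {a b} → power a ≡ power b → a ≡ b
  power-inj {a} {b} e = toℕ-injective (pow-inj (toℕ<n a) (toℕ<n b)
                          (R-inj (punchOut-injective (g^≢0 (toℕ a)) (g^≢0 (toℕ b)) e)))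

  powers-cover : ∀ (i : Fin n) → i ≢ fz → ∃ λ j → R (g ^ j) ≡ i
  powers-cover fz i≢0 = contradiction refl i≢0
  powers-cover (fs y) _ with injective⇒surjective power power-inj y
  ... | j , power-j≡y = toℕ j , trans (sym (punchIn-punchOut (g^≢0 (toℕ j)))) (cong (punchIn fz) power-j≡y)

module Multiplicity {A : Set} (_≟_ : DecidableEquality A) where
  open import Data.Nat using (suc; _≤_; s≤s)
  open import Data.Nat.Properties using (≤-refl; ≤-trans)
  open import Data.Integer using (ℤ; +_; _+_; _*_)
  import Data.Integer.Properties as ℤP
  open import Algebra.Properties.CommutativeSemigroup ℤP.+-commutativeSemigroup using (x∙yz≈y∙xz)
  open import Data.List using (List; []; _∷_; map; filter; length; deduplicate)
  open import Data.List.Properties using (length-filter; filter-accept; filter-reject)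
  open import Data.List.Membership.Propositional using (_∈_)
  open import Data.List.Membership.Propositional.Properties using (∈-filter⁻)
  open import Data.List.Relation.Unary.Any using (here; there)
  open import Data.Product using (_,_)
  open import Relation.Nullary using (¬_; yes; no; ¬?; Dec; contradiction)
  open import Relation.Unary using (Pred; Decidable)
  open import Relation.Binary.PropositionalEquality
  open import Function using (_∘_)
  open import Level using (0ℓ)
  open import Defs using (sumℤ)

  filter-comm : ∀ {P Q : Pred A 0ℓ} (P? : Decidable P) (Q? : Decidable Q) l →
    filter P? (filter Q? l) ≡ filter Q? (filter P? l)
  filter-comm P? Q? [] = refl
  filter-comm {P} {Q} P? Q? (x ∷ l) = by-cases (P? x) (Q? x)
    where
    by-cases : Dec (P x) → Dec (Q x) → filter P? (filter Q? (x ∷ l)) ≡ filter Q? (filter P? (x ∷ l))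
    by-cases (yes px) (yes qx) = begin
      filter P? (filter Q? (x ∷ l))  ≡⟨ cong (filter P?) (filter-accept Q? qx) ⟩
      filter P? (x ∷ filter Q? l)    ≡⟨ filter-accept P? px ⟩
      x ∷ filter P? (filter Q? l)    ≡⟨ cong (x ∷_) (filter-comm P? Q? l) ⟩
      x ∷ filter Q? (filter P? l)    ≡⟨ filter-accept Q? qx ⟨
      filter Q? (x ∷ filter P? l)    ≡⟨ cong (filter Q?) (filter-accept P? px) ⟨
      filter Q? (filter P? (x ∷ l))  ∎
      where open ≡-Reasoning
    by-cases (yes px) (no ¬qx) = trans (cong (filter P?) (filter-reject Q? ¬qx))
      (trans (filter-comm P? Q? l) (sym (trans (cong (filter Q?) (filter-accept P? px)) (filter-reject Q? ¬qx))))
    by-cases (no ¬px) (yes qx) = trans (cong (filter P?) (filter-accept Q? qx))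
      (trans (filter-reject P? ¬px) (trans (filter-comm P? Q? l) (sym (cong (filter Q?) (filter-reject P? ¬px)))))
    by-cases (no ¬px) (no ¬qx) = trans (cong (filter P?) (filter-reject Q? ¬qx))
      (trans (filter-comm P? Q? l) (sym (cong (filter Q?) (filter-reject P? ¬px))))

  filter-absorb : ∀ {P Q : Pred A 0ℓ} (P? : Decidable P) (Q? : Decidable Q) → (∀ {z} → P z → Q z) → ∀ l →
    filter P? (filter Q? l) ≡ filter P? l
  filter-absorb P? Q? P⇒Q [] = refl
  filter-absorb {P} {Q} P? Q? P⇒Q (x ∷ l) = by-cases (P? x) (Q? x)
    where
    by-cases : Dec (P x) → Dec (Q x) → filter P? (filter Q? (x ∷ l)) ≡ filter P? (x ∷ l)
    by-cases (yes px) (yes qx) = trans (cong (filter P?) (filter-accept Q? qx))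
      (trans (filter-accept P? px) (trans (cong (x ∷_) (filter-absorb P? Q? P⇒Q l)) (sym (filter-accept P? px))))
    by-cases (yes px) (no ¬qx) = contradiction (P⇒Q px) ¬qx
    by-cases (no ¬px) (yes qx) = trans (cong (filter P?) (filter-accept Q? qx))
      (trans (filter-reject P? ¬px) (trans (filter-absorb P? Q? P⇒Q l) (sym (filter-reject P? ¬px))))
    by-cases (no ¬px) (no ¬qx) = trans (cong (filter P?) (filter-reject Q? ¬qx))
      (trans (filter-absorb P? Q? P⇒Q l) (sym (filter-reject P? ¬px)))

  dedup : List A → List A
  dedup = deduplicate _≟_

  dedup-filter : ∀ {P : Pred A 0ℓ} (P? : Decidable P) l → dedup (filter P? l) ≡ filter P? (dedup l)
  dedup-filter P? [] = refl
  dedup-filter {P} P? (y ∷ l) = by-cases (P? y)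
    where
    by-cases : Dec (P y) → dedup (filter P? (y ∷ l)) ≡ filter P? (dedup (y ∷ l))
    by-cases (yes py) = trans (cong dedup (filter-accept P? py))
      (trans (cong (λ z → y ∷ filter (¬? ∘ (y ≟_)) z) (dedup-filter P? l))
      (trans (cong (y ∷_) (filter-comm (¬? ∘ (y ≟_)) P? (dedup l))) (sym (filter-accept P? py))))
    by-cases (no ¬py) = trans (cong dedup (filter-reject P? ¬py)) (trans (dedup-filter P? l)
      (trans (sym (filter-absorb P? (¬? ∘ (y ≟_)) (λ pz y≡z → ¬py (subst P (sym y≡z) pz)) (dedup l)))
             (sym (filter-reject P? ¬py))))

  Σ[_]_ : List A → (A → ℤ) → ℤ
  Σ[ l ] h = sumℤ (map h l)

  Σ-partition : ∀ {P : Pred A 0ℓ} (P? : Decidable P) h l → Σ[ l ] h ≡ Σ[ filter P? l ] h + Σ[ filter (¬? ∘ P?) l ] h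
  Σ-partition P? h [] = refl
  Σ-partition P? h (x ∷ l) with P? x
  ... | yes px = trans (cong (λ s → h x + s) (Σ-partition P? h l))
                       (sym (ℤP.+-assoc (h x) (Σ[ filter P? l ] h) (Σ[ filter (¬? ∘ P?) l ] h)))
  ... | no ¬px = trans (cong (λ s → h x + s) (Σ-partition P? h l))
                       (x∙yz≈y∙xz (h x) (Σ[ filter P? l ] h) (Σ[ filter (¬? ∘ P?) l ] h))

  count : A → List A → ℕ
  count y l = length (filter (y ≟_) l)

  Σ-copies : ∀ x h l → Σ[ filter (x ≟_) l ] h ≡ + count x l * h x
  Σ-copies x h [] = refl
  Σ-copies x h (y ∷ l) with x ≟ y
  ... | yes refl = begin
    h x + Σ[ filter (x ≟_) l ] h    ≡⟨ cong (λ s → h x + s) (Σ-copies x h l) ⟩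
    h x + + count x l * h x         ≡⟨ cong (_+ + count x l * h x) (ℤP.*-identityˡ (h x)) ⟨
    + 1 * h x + + count x l * h x   ≡⟨ ℤP.*-distribʳ-+ (h x) (+ 1) (+ count x l) ⟨
    + suc (count x l) * h x         ∎
    where open ≡-Reasoning
  ... | no _ = Σ-copies x h l

  -- Induction on the length bound k: remove all copies of the head.
  Σ-uniform-multiplicity : ∀ e h xs → (∀ y → y ∈ xs → count y xs ≡ e) → Σ[ xs ] h ≡ + e * Σ[ dedup xs ] h
  Σ-uniform-multiplicity e h xs = go (length xs) xs ≤-refl
    where
    go : ∀ k xs → length xs ≤ k → (∀ y → y ∈ xs → count y xs ≡ e) → Σ[ xs ] h ≡ + e * Σ[ dedup xs ] h
    go k [] _ _ = sym (ℤP.*-zeroʳ (+ e))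
    go (suc k) (x ∷ xs) (s≤s len) uniform = begin
      h x + Σ[ xs ] h                                ≡⟨ cong (λ s → h x + s) (Σ-partition (x ≟_) h xs) ⟩
      h x + (Σ[ filter (x ≟_) xs ] h + Σ[ rest ] h)  ≡⟨ cong (λ z → h x + (z + Σ[ rest ] h)) (Σ-copies x h xs) ⟩
      h x + (+ c * h x + Σ[ rest ] h)                ≡⟨ ℤP.+-assoc (h x) (+ c * h x) (Σ[ rest ] h) ⟨
      h x + + c * h x + Σ[ rest ] h                  ≡⟨ cong (_+ Σ[ rest ] h) head-copies ⟩
      + e * h x + Σ[ rest ] h                        ≡⟨ cong (λ s → + e * h x + s) (go k rest shorter uniform-rest) ⟩
      + e * h x + + e * Σ[ dedup rest ] h            ≡⟨ ℤP.*-distribˡ-+ (+ e) (h x) (Σ[ dedup rest ] h) ⟨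
      + e * (h x + Σ[ dedup rest ] h)                ≡⟨ cong (λ z → + e * (h x + Σ[ z ] h)) (dedup-filter (¬? ∘ (x ≟_)) xs) ⟩
      + e * Σ[ dedup (x ∷ xs) ] h                    ∎
      where
      open ≡-Reasoning
      rest = filter (¬? ∘ (x ≟_)) xs
      c = count x xs
      head-count : suc c ≡ e
      head-count = trans (sym (cong length (filter-accept (x ≟_) {x} {xs} refl))) (uniform x (here refl))
      shorter : length rest ≤ k
      shorter = ≤-trans (length-filter _ xs) len
      head-copies : h x + + c * h x ≡ + e * h x
      head-copies = begin
        h x + + c * h x          ≡⟨ cong (_+ + c * h x) (ℤP.*-identityˡ (h x)) ⟨
        + 1 * h x + + c * h x    ≡⟨ ℤP.*-distribʳ-+ (h x) (+ 1) (+ c) ⟨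
        + suc c * h x            ≡⟨ cong (λ z → + z * h x) head-count ⟩
        + e * h x                ∎
      uniform-rest : ∀ y → y ∈ rest → count y rest ≡ e
      uniform-rest y y∈rest with ∈-filter⁻ (¬? ∘ (x ≟_)) {xs = xs} y∈rest
      ... | y∈xs , x≢y = begin
        count y rest        ≡⟨ cong length (filter-absorb (y ≟_) (¬? ∘ (x ≟_)) (λ y≡z x≡z → x≢y (trans x≡z (sym y≡z))) xs) ⟩
        count y xs          ≡⟨ cong length (filter-reject (y ≟_) {x} {xs} (x≢y ∘ sym)) ⟨
        count y (x ∷ xs)    ≡⟨ uniform y (there y∈xs) ⟩
        e                   ∎

-- Translates of a subset S ⊆ ℤ/d: S + u = S + t iff t - u stabilises S, so each
-- translate occurs exactly |Stab(S)| times in the list (S + t)_{t < d}.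
module Translation (d' : ℕ) where
  open Residues d' renaming (n to d)
  open Counting
  open import Data.Fin using (Fin)
  open import Data.Fin.Permutation using (flip)
  open import Data.Fin.Subset using (Subset)
  open import Data.List using (List; map; filter; length; allFin)
  open import Data.List.Properties using (filter-≐)
  open import Data.List.Membership.Propositional using (_∈_)
  open import Data.List.Membership.Propositional.Properties using (∈-map⁻)
  open import Data.Vec using (lookup)
  open import Data.Vec.Properties using (lookup∘tabulate)
  open import Data.Vec.Relation.Binary.Pointwise.Extensional using (ext; Pointwise-≡⇒≡)
  open import Data.Product using (_,_)
  open import Relation.Binary.PropositionalEquality
  open import Defs using (shift; _≟S_; stabOrder)
  open Multiplicity (_≟S_ {d}) using (count)

  translates : Subset d → List (Subset d)
  translates S = map (λ t → shift t S) (allFin d)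

  lookup-shift : ∀ (t : Fin d) (S : Subset d) i → lookup (shift t S) i ≡ lookup S (i ⊟ t)
  lookup-shift t S i = lookup∘tabulate (λ i → lookup S (i ⊟ t)) i

  shift-≡⇒stab : ∀ (S : Subset d) u t → shift u S ≡ shift t S → shift (t ⊟ u) S ≡ S
  shift-≡⇒stab S u t e = Pointwise-≡⇒≡ (ext λ i → begin
    lookup (shift (t ⊟ u) S) i   ≡⟨ lookup-shift (t ⊟ u) S i ⟩
    lookup S (i ⊟ (t ⊟ u))       ≡⟨ cong (lookup S) (⊞-⊟ i u t) ⟨
    lookup S (i ⊞ u ⊟ t)         ≡⟨ lookup-shift t S (i ⊞ u) ⟨
    lookup (shift t S) (i ⊞ u)   ≡⟨ cong (λ z → lookup z (i ⊞ u)) e ⟨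
    lookup (shift u S) (i ⊞ u)   ≡⟨ lookup-shift u S (i ⊞ u) ⟩
    lookup S (i ⊞ u ⊟ u)         ≡⟨ cong (lookup S) (⊞⊟ i u) ⟩
    lookup S i                   ∎)
    where open ≡-Reasoning

  stab⇒shift-≡ : ∀ (S : Subset d) u t → shift (t ⊟ u) S ≡ S → shift u S ≡ shift t S
  stab⇒shift-≡ S u t e = Pointwise-≡⇒≡ (ext λ j → begin
    lookup (shift u S) j                   ≡⟨ lookup-shift u S j ⟩
    lookup S (j ⊟ u)                       ≡⟨ cong (λ z → lookup z (j ⊟ u)) e ⟨
    lookup (shift (t ⊟ u) S) (j ⊟ u)       ≡⟨ lookup-shift (t ⊟ u) S (j ⊟ u) ⟩
    lookup S (j ⊟ u ⊟ (t ⊟ u))             ≡⟨ cong (lookup S) (⊟-cancelʳ j u t) ⟩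
    lookup S (j ⊟ t)                       ≡⟨ lookup-shift t S j ⟨
    lookup (shift t S) j                   ∎)
    where open ≡-Reasoning

  translate-multiplicity : ∀ (S : Subset d) T → T ∈ translates S → count T (translates S) ≡ stabOrder S
  translate-multiplicity S T T∈ with ∈-map⁻ (λ (t : Fin d) → shift t S) {xs = allFin d} T∈
  ... | u , _ , refl = begin
    length (filter (shift u S ≟S_) (translates S))
      ≡⟨ length-filter-map (shift u S ≟S_) (λ t → shift t S) (allFin d) ⟩
    length (filter (λ t → shift u S ≟S shift t S) (allFin d))
      ≡⟨ cong length (filter-≐ (λ t → shift u S ≟S shift t S) (λ t → shift (t ⊟ u) S ≟S S)
                               ((λ {t} → shift-≡⇒stab S u t) , (λ {t} → stab⇒shift-≡ S u t)) (allFin d)) ⟩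
    length (filter (λ t → shift (t ⊟ u) S ≟S S) (allFin d))
      ≡⟨ count-permute (λ t → shift t S ≟S S) (flip (⊞-perm u)) ⟩
    stabOrder S ∎
    where open ≡-Reasoning

module Rotation {c ℓ} (M : CommutativeMonoid c ℓ) where
  open CommutativeMonoid M
  open import Data.Nat using (zero; suc)
  open import Data.Fin using (toℕ)
  open import Function using (_∘_)
  open import Algebra.Properties.CommutativeMonoid.Sum M using (sum)
  open import Relation.Binary.Reasoning.Setoid setoid

  Σ< : ℕ → (ℕ → Carrier) → Carrier
  Σ< k f = sum {k} (λ j → f (toℕ j))

  Σ<-snoc : ∀ k (f : ℕ → Carrier) → Σ< (suc k) f ≈ Σ< k f ∙ f k
  Σ<-snoc zero f = trans (identityʳ (f 0)) (sym (identityˡ (f 0)))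
  Σ<-snoc (suc k) f = begin
    f 0 ∙ Σ< (suc k) (f ∘ suc)       ≈⟨ ∙-congˡ (Σ<-snoc k (f ∘ suc)) ⟩
    f 0 ∙ (Σ< k (f ∘ suc) ∙ f (suc k)) ≈⟨ assoc _ _ _ ⟨
    f 0 ∙ Σ< k (f ∘ suc) ∙ f (suc k)   ∎

  Σ<-rotate : ∀ k (f : ℕ → Carrier) → f k ≈ f 0 → Σ< k (f ∘ suc) ≈ Σ< k f
  Σ<-rotate zero f _ = refl
  Σ<-rotate (suc k) f fk≈f0 = begin
    Σ< (suc k) (f ∘ suc)        ≈⟨ Σ<-snoc k (f ∘ suc) ⟩
    Σ< k (f ∘ suc) ∙ f (suc k)  ≈⟨ ∙-congˡ fk≈f0 ⟩
    Σ< k (f ∘ suc) ∙ f 0        ≈⟨ comm _ _ ⟩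
    f 0 ∙ Σ< k (f ∘ suc)        ∎

module GaussianPeriods (p' g d' m : ℕ)
    (g^-unit : ∀ t {a b} → Residues._~_ p' (g ℕ.^ t ℕ.* a) (g ℕ.^ t ℕ.* b) → Residues._~_ p' a b)
    (g^md~1 : Residues._~_ p' (g ℕ.^ (m ℕ.* suc d')) 1) where
  open Galois p' public
  open Sums using (sum; sum-cong-≗; sum-const)
  open import Data.Nat using (zero; suc; _+_; _*_; _^_; _%_; _/_; _≟_)
  open import Data.Nat.ListAction using () renaming (sum to sumℕ)
  import Data.Nat.Properties as ℕP
  open import Algebra.Properties.CommutativeSemigroup ℕP.+-commutativeSemigroup using (x∙yz≈y∙xz)
  open import Data.Nat.DivMod using (m≡m%n+[m/n]*n)
  import Data.Integer as ℤ
  open ℤ using (+_)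
  import Data.Integer.Properties as ℤP
  open import Data.Fin using (Fin; toℕ)
  open import Data.Fin.Subset using (Subset)
  open import Data.Fin.Subset.Properties using (_∈?_)
  open import Data.List using (List; []; _∷_; map; allFin; filter; length)
  open import Data.List.Properties using (map-∘; filter-accept; filter-reject)
  open import Data.Vec using (lookup)
  open import Data.Vec.Properties using (lookup⇒[]=; []=⇒lookup)
  open import Data.Bool using (true; false; if_then_else_)
  open import Relation.Binary.PropositionalEquality
  open import Function using (_∘_)
  open import Defs
  module ℤd = Residues d'

  d : ℕ
  d = suc d'

  open Periods n g d m public using (C; η; elems; ηS; choices; zS)

  g-unit : ∀ {a b} → g * a ~ g * b → a ~ b
  g-unit {a} {b} e = g^-unit 1 (~-trans (≡⇒~ (cong (_* a) (ℕP.*-identityʳ g)))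
                                (~-trans e (≡⇒~ (cong (_* b) (sym (ℕP.*-identityʳ g))))))

  period-term : ℕ → ℕ → Cyc n
  period-term s j = ζ^ (g ^ (j * d + s) % n)

  η-Σ : ∀ s → η s ≡ Σ.sum (λ (j : Fin m) → period-term s (toℕ j))
  η-Σ s = trans (cong ΣC (sym (map-∘ {g = ζ^} {f = λ j → g ^ (toℕ j * d + s) % n} (allFin m))))
                (ΣC-allFin {m} (λ j → period-term s (toℕ j)))

  η-≡ : ∀ {s t} → s ≡ t → η s ≋ η t
  η-≡ refl = ≋-refl

  D-η : ∀ t s → D (g ^ t) (η s) ≋ η (t + s)
  D-η t s = begin
    D (g ^ t) (η s)                               ≡⟨ cong (D (g ^ t)) (η-Σ s) ⟩
    D (g ^ t) (Σ.sum {m} (period-term s ∘ toℕ))   ≈⟨ D-Σ (g ^ t) {m} (period-term s ∘ toℕ) ⟩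
    Σ.sum {m} (D (g ^ t) ∘ period-term s ∘ toℕ)   ≈⟨ Σ.sum-cong-≋ {m} term ⟩
    Σ.sum {m} (period-term (t + s) ∘ toℕ)         ≡⟨ η-Σ (t + s) ⟨
    η (t + s)                                     ∎
    where
    open ≋-Reasoning
    exponent : ∀ j → g ^ t * (g ^ (j * d + s) % n) ~ g ^ (j * d + (t + s)) % n
    exponent j = ~-trans (*~ (~-refl {g ^ t}) (%~ _)) (~-trans (≡⇒~ (sym (ℕP.^-distribˡ-+-* g t _)))
                   (~-trans (≡⇒~ (cong (g ^_) (x∙yz≈y∙xz t (j * d) s))) (~-sym (%~ _))))
    term : ∀ (j : Fin m) → D (g ^ t) (period-term s (toℕ j)) ≋ period-term (t + s) (toℕ j)
    term j = ≋-trans (D-ζ (g ^ t) (g ^ (toℕ j * d + s) % n)) (ζ-cong (exponent (toℕ j)))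

  -- η_(d+s) = η_s: the terms are rotated, and g^(md+s) ≡ g^s
  η-period : ∀ s → η (d + s) ≋ η s
  η-period s = begin
    η (d + s)                               ≡⟨ η-Σ (d + s) ⟩
    Σ.sum {m} (period-term (d + s) ∘ toℕ)   ≈⟨ Σ.sum-cong-≋ {m} (λ j → reindex (toℕ j)) ⟩
    ΣRot.Σ< m (period-term s ∘ suc)         ≈⟨ ΣRot.Σ<-rotate m (period-term s) (ζ-cong wrap) ⟩
    Σ.sum {m} (period-term s ∘ toℕ)         ≡⟨ η-Σ s ⟨
    η s                                     ∎
    where
    open ≋-Reasoning
    module ΣRot = Rotation ⊕-commutativeMonoid
    reindex : ∀ j → period-term (d + s) j ≋ period-term s (suc j)
    reindex j = ζ-cong (≡⇒~ (cong (λ e → g ^ e % n)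
                  (trans (sym (ℕP.+-assoc (j * d) d s)) (cong (_+ s) (ℕP.+-comm (j * d) d)))))
    wrap : g ^ (m * d + s) % n ~ g ^ (0 + s) % n
    wrap = ~-trans (%~ _) (~-trans (≡⇒~ (ℕP.^-distribˡ-+-* g (m * d) s))
             (~-trans (*~ g^md~1 (~-refl {g ^ s})) (~-trans (≡⇒~ (ℕP.+-identityʳ (g ^ s))) (~-sym (%~ _)))))

  η-mult : ∀ q s → η (s + q * d) ≋ η s
  η-mult zero s = η-≡ (ℕP.+-identityʳ s)
  η-mult (suc q) s = ≋-trans (η-≡ (x∙yz≈y∙xz s d (q * d))) (≋-trans (η-period (s + q * d)) (η-mult q s))

  η-mod : ∀ s → η (s % d) ≋ η s
  η-mod s = ≋-trans (≋-sym (η-mult (s / d) (s % d))) (η-≡ (sym (m≡m%n+[m/n]*n s d)))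

  ε-η : ∀ s → ε (η s) ≡ + m
  ε-η s = begin
    ε (η s)                                    ≡⟨ cong ε (η-Σ s) ⟩
    ε (Σ.sum {m} (period-term s ∘ toℕ))        ≡⟨ ε-Σ {m} (period-term s ∘ toℕ) ⟩
    sum {m} (λ j → ε (period-term s (toℕ j)))  ≡⟨ sum-cong-≗ {m} (λ j → ε-ζ (g ^ (toℕ j * d + s) % n)) ⟩
    sum {m} (λ _ → + 1)                        ≡⟨ sum-const m (+ 1) ⟩
    + m ℤ.* + 1                                ≡⟨ ℤP.*-identityʳ (+ m) ⟩
    + m                                        ∎
    where open ≡-Reasoning

  ε-Πη : ∀ l → ε (ΠC (map η l)) ≡ + (m ^ length l)
  ε-Πη [] = ε-ζ 0
  ε-Πη (s ∷ l) = trans (ε-⊛ (η s) (ΠC (map η l)))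
                       (trans (cong₂ ℤ._*_ (ε-η s) (ε-Πη l)) (sym (ℤP.pos-* m (m ^ length l))))

  -- η_S as a product over all of ℤ/d, with the periods shifted by t
  factor : ℕ → Subset d → Fin d → Cyc n
  factor t T j = if lookup T j then η (t + toℕ j) else 𝟙

  ηS-Π : ∀ (T : Subset d) → ηS T ≋ Π.sum (factor 0 T)
  ηS-Π T = ≋-trans (over (allFin d)) (λ i → cong (λ z → z i) (ΠC-allFin (factor 0 T)))
    where
    over : ∀ l → ΠC (map η (map toℕ (filter (_∈? T) l))) ≋ ΠC (map (factor 0 T) l)
    over [] = ≋-refl
    over (x ∷ l) with lookup T x in eq
    ... | true = ≋-trans (λ i → cong (λ z → ΠC (map η (map toℕ z)) i) (filter-accept (_∈? T) (lookup⇒[]= x T eq)))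
                         (⊛-cong {η (toℕ x)} ≋-refl (over l))
    ... | false = ≋-trans (λ i → cong (λ z → ΠC (map η (map toℕ z)) i)
                                      (filter-reject (_∈? T) (λ x∈T → true≢false (trans (sym ([]=⇒lookup x∈T)) eq))))
                          (≋-trans (over l) (≋-sym (⊛-identityˡ _)))
      where
      true≢false : true ≢ false
      true≢false ()

  D-ηS : ∀ t (T : Subset d) → D (g ^ t) (ηS T) ≋ Π.sum (factor t T)
  D-ηS t T = begin
    D (g ^ t) (ηS T)                  ≈⟨ D-cong (g ^ t) (ηS-Π T) ⟩
    D (g ^ t) (Π.sum (factor 0 T))    ≈⟨ D-Π (g ^ t) (factor 0 T) ⟩
    Π.sum (D (g ^ t) ∘ factor 0 T)    ≈⟨ Π.sum-cong-≋ shift-factor ⟩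
    Π.sum (factor t T)                ∎
    where
    open ≋-Reasoning
    shift-factor : ∀ j → D (g ^ t) (factor 0 T j) ≋ factor t T j
    shift-factor j with lookup T j
    ... | true  = D-η t (toℕ j)
    ... | false = D-𝟙 (g ^ t)

  ηS-shift : ∀ (t : Fin d) (S : Subset d) → ηS (shift t S) ≋ D (g ^ toℕ t) (ηS S)
  ηS-shift t S = begin
    ηS (shift t S)                     ≈⟨ ηS-Π (shift t S) ⟩
    Π.sum (factor 0 (shift t S))       ≈⟨ Π.sum-cong-≋ (λ i → ≋-reflexive (cong (λ b → if b then η (toℕ i) else 𝟙)
                                                                            (Translation.lookup-shift d' t S i))) ⟩
    Π.sum unshifted                    ≈⟨ Π.∑-permute unshifted (ℤd.⊞-perm t) ⟩
    Π.sum (λ j → unshifted (j ℤd.⊞ t)) ≈⟨ Π.sum-cong-≋ translate ⟩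
    Π.sum (factor (toℕ t) S)           ≈⟨ D-ηS (toℕ t) S ⟨
    D (g ^ toℕ t) (ηS S)               ∎
    where
    open ≋-Reasoning
    unshifted : Fin d → Cyc n
    unshifted i = if lookup S (i ℤd.⊟ t) then η (toℕ i) else 𝟙
    translate : ∀ j → unshifted (j ℤd.⊞ t) ≋ factor (toℕ t) S j
    translate j rewrite ℤd.⊞⊟ j t with lookup S j
    ... | true  = ≋-trans (η-≡ (trans (ℤd.toℕ-R (toℕ j + toℕ t)) (cong (_% d) (ℕP.+-comm (toℕ j) (toℕ t)))))
                          (η-mod (toℕ t + toℕ j))
    ... | false = ≋-refl

  D-ηS-period : ∀ (S : Subset d) → D (g ^ d) (ηS S) ≋ D (g ^ 0) (ηS S)
  D-ηS-period S = ≋-trans (D-ηS d S) (≋-trans (Π.sum-cong-≋ unshift) (≋-sym (D-ηS 0 S)))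
    where
    unshift : ∀ j → factor d S j ≋ factor 0 S j
    unshift j with lookup S j
    ... | true  = η-period (toℕ j)
    ... | false = ≋-refl

  zS-∷ : ∀ (T : Subset d) s₁ rest → elems T ≡ s₁ ∷ rest →
    zS T ≡ length (filter (λ xs → (sumℕ xs % n) ≟ 0) (choices ((g ^ s₁ % n ∷ []) ∷ map C rest)))
  zS-∷ T s₁ rest eq with elems T | eq
  ... | .(s₁ ∷ rest) | refl = refl

-- The orbit sum V = Σ_{t<d} η_(S+t) = Σ_{t<d} σ_(g^t) η_S.  It is σ_g-invariant,
-- hence constant on the nonzero residues g^j; its value at 0 is d·η_S(0), and
-- ε(V) = d·ε(η_S).
module OrbitSum (p' g d' m : ℕ)
    (g^-unit : ∀ t {a b} → Residues._~_ p' (g ℕ.^ t ℕ.* a) (g ℕ.^ t ℕ.* b) → Residues._~_ p' a b)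
    (g^md~1 : Residues._~_ p' (g ℕ.^ (m ℕ.* suc d')) 1)
    (S : Subset (suc d')) where
  open GaussianPeriods p' g d' m g^-unit g^md~1 public
  open Sums using (sum; sum-cong-≗; sum-const; sumℤ-allFin)
  open import Data.Nat using (zero; suc; _^_; _%_)
  import Data.Nat.Properties as ℕP
  import Data.Integer as ℤ
  open ℤ using (ℤ; +_)
  import Data.Integer.Properties as ℤP
  open import Data.Fin using (Fin; toℕ) renaming (zero to fz)
  open import Data.Fin.Subset using (Subset)
  open import Data.List using (List; []; _∷_; map; allFin)
  open import Data.List.Properties using (map-∘)
  open import Relation.Binary.PropositionalEquality
  open import Function using (_∘_)
  open import Defs

  W : Cyc n
  W = ηS S

  V : Cyc n
  V = Σ.sum (λ (t : Fin d) → D (g ^ toℕ t) W)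

  V-invariant : D g V ≋ V
  V-invariant = begin
    D g V                                           ≈⟨ D-Σ g {d} (λ t → D (g ^ toℕ t) W) ⟩
    Σ.sum {d} (λ t → D g (D (g ^ toℕ t) W))         ≈⟨ Σ.sum-cong-≋ {d} (λ t → D-∘ g (g ^ toℕ t) W) ⟩
    ΣRot.Σ< d (λ t → D (g ^ suc t) W)               ≈⟨ ΣRot.Σ<-rotate d (λ t → D (g ^ t) W) (D-ηS-period S) ⟩
    V                                               ∎
    where
    open ≋-Reasoning
    module ΣRot = Rotation ⊕-commutativeMonoid

  V-g· : ∀ x → V (g ·R x) ≡ V x
  V-g· x = trans (sym (V-invariant (g ·R x))) (Unit.D-at g g-unit V x)

  V-power : ∀ j → V (R (g ^ j)) ≡ V (R 1)
  V-power zero = refl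
  V-power (suc j) = trans (cong V (R-cong (*~ (~-refl {g}) (~-sym (R~ (g ^ j)))))) (trans (V-g· (R (g ^ j))) (V-power j))

  V-at-0 : V fz ≡ + d ℤ.* W fz
  V-at-0 = begin
    V fz                                ≡⟨ Σ-at {d} (λ t → D (g ^ toℕ t) W) fz ⟩
    sum {d} (λ t → D (g ^ toℕ t) W fz)  ≡⟨ sum-cong-≗ {d} (λ t → Unit.D-at0 (g ^ toℕ t) (g^-unit (toℕ t)) W) ⟩
    sum {d} (λ _ → W fz)                ≡⟨ sum-const d (W fz) ⟩
    + d ℤ.* W fz                        ∎
    where open ≡-Reasoning

  ε-V : ε V ≡ + d ℤ.* ε W
  ε-V = begin
    ε V                                 ≡⟨ ε-Σ {d} (λ t → D (g ^ toℕ t) W) ⟩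
    sum {d} (λ t → ε (D (g ^ toℕ t) W)) ≡⟨ sum-cong-≗ {d} (λ t → ε-D (g ^ toℕ t) W) ⟩
    sum {d} (λ _ → ε W)                 ≡⟨ sum-const d (ε W) ⟩
    + d ℤ.* ε W                         ∎
    where open ≡-Reasoning

  translates-sum : ΣC (map ηS (Translation.translates d' S)) ≋ V
  translates-sum = begin
    ΣC (map ηS (map (λ t → shift t S) (allFin d)))   ≡⟨ cong ΣC (sym (map-∘ {g = ηS} {f = λ t → shift t S} (allFin d))) ⟩
    ΣC (map (λ t → ηS (shift t S)) (allFin d))       ≡⟨ ΣC-allFin (λ t → ηS (shift t S)) ⟩
    Σ.sum {d} (λ t → ηS (shift t S))                 ≈⟨ Σ.sum-cong-≋ {d} (λ t → ηS-shift t S) ⟩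
    V                                                ∎
    where open ≋-Reasoning

  -- With S = {s₁ < …}, η_S(0) = m·z(S): the coefficient of ζ^0 in η_(s₁)·R, R the
  -- product of the other periods, is Σ_j R(-g^(jd+s₁)), and R is σ_(g^(jd))-invariant.
  module FirstElement (s₁ : ℕ) (rest : List ℕ) (elems≡ : elems S ≡ s₁ ∷ rest) where
    Rest : Cyc n
    Rest = ΠC (map η rest)

    y : ℕ
    y = g ^ s₁ % n

    D-Rest : ∀ q → D (g ^ (q ℕ.* d)) Rest ≋ Rest
    D-Rest q = begin
      D (g ^ (q ℕ.* d)) (ΠC (map η rest))            ≈⟨ D-ΠC (g ^ (q ℕ.* d)) (map η rest) ⟩
      ΠC (map (D (g ^ (q ℕ.* d))) (map η rest))      ≡⟨ cong ΠC (sym (map-∘ {g = D (g ^ (q ℕ.* d))} {f = η} rest)) ⟩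
      ΠC (map (D (g ^ (q ℕ.* d)) ∘ η) rest)          ≈⟨ ΠC-cong rest (λ s → ≋-trans (D-η (q ℕ.* d) s)
                                                          (≋-trans (η-≡ (ℕP.+-comm (q ℕ.* d) s)) (η-mult q s))) ⟩
      ΠC (map η rest)                                ∎
      where open ≋-Reasoning

    neg-power : ∀ q → g ^ q ·R (fz ⊟ R y) ≡ fz ⊟ R (g ^ (q ℕ.+ s₁) % n)
    neg-power q = ⊟-unique {fz} {R (g ^ (q ℕ.+ s₁) % n)} (begin
      toℕ (c ·R a) ℕ.+ toℕ (R (g ^ (q ℕ.+ s₁) % n))  ≈⟨ +~ (R~ (c ℕ.* toℕ a)) (R%~ (g ^ (q ℕ.+ s₁))) ⟩
      c ℕ.* toℕ a ℕ.+ g ^ (q ℕ.+ s₁)                  ≡⟨ cong (c ℕ.* toℕ a ℕ.+_) (ℕP.^-distribˡ-+-* g q s₁) ⟩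
      c ℕ.* toℕ a ℕ.+ c ℕ.* g ^ s₁                    ≈⟨ +~ (~-refl {c ℕ.* toℕ a}) (*~ (~-refl {c}) (~-sym (R%~ (g ^ s₁)))) ⟩
      c ℕ.* toℕ a ℕ.+ c ℕ.* toℕ (R y)                 ≡⟨ ℕP.*-distribˡ-+ c (toℕ a) (toℕ (R y)) ⟨
      c ℕ.* (toℕ a ℕ.+ toℕ (R y))                     ≈⟨ *~ (~-refl {c}) (⊟-spec fz (R y)) ⟩
      c ℕ.* 0                                         ≡⟨ ℕP.*-zeroʳ c ⟩
      0                                               ∎)
      where
      open ~-Reasoning
      c = g ^ q
      a = fz ⊟ R y

    -- R(-g^(jd+s₁)) = (σ_(g^(jd)) R)(g^(jd)·(-g^s₁)) = R(-g^s₁)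
    Rest-const : ∀ (j : Fin m) → Rest (fz ⊟ R (g ^ (toℕ j ℕ.* d ℕ.+ s₁) % n)) ≡ Rest (fz ⊟ R y)
    Rest-const j = begin
      Rest (fz ⊟ R (g ^ (q ℕ.+ s₁) % n))   ≡⟨ cong Rest (neg-power q) ⟨
      Rest (c ·R (fz ⊟ R y))               ≡⟨ D-Rest (toℕ j) (c ·R (fz ⊟ R y)) ⟨
      D c Rest (c ·R (fz ⊟ R y))           ≡⟨ Unit.D-at c (g^-unit q) Rest (fz ⊟ R y) ⟩
      Rest (fz ⊟ R y)                      ∎
      where
      open ≡-Reasoning
      q = toℕ j ℕ.* d
      c = g ^ q

    W-at-0 : W fz ≡ + m ℤ.* Rest (fz ⊟ R y)
    W-at-0 = begin
      ΠC (map η (elems S)) fz                      ≡⟨ cong (λ l → ΠC (map η l) fz) elems≡ ⟩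
      (η s₁ ⊛ Rest) fz                             ≡⟨ ΣCζ-conv (C s₁) Rest fz ⟩
      sumℤ (map (λ x → Rest (fz ⊟ R x)) (C s₁))    ≡⟨ cong sumℤ (sym (map-∘ {g = Rest ∘ (fz ⊟_) ∘ R} {f = power} (allFin m))) ⟩
      sumℤ (map (λ j → Rest (fz ⊟ R (power j))) (allFin m))
                                                   ≡⟨ sumℤ-allFin {m} (λ j → Rest (fz ⊟ R (power j))) ⟩
      sum {m} (λ j → Rest (fz ⊟ R (power j)))      ≡⟨ sum-cong-≗ {m} Rest-const ⟩
      sum {m} (λ _ → Rest (fz ⊟ R y))              ≡⟨ sum-const m (Rest (fz ⊟ R y)) ⟩
      + m ℤ.* Rest (fz ⊟ R y)                      ∎
      where
      open ≡-Reasoning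
      power : Fin m → ℕ
      power j = g ^ (toℕ j ℕ.* d ℕ.+ s₁) % n

    zS≡Rest : + zS S ≡ Rest (fz ⊟ R y)
    zS≡Rest = begin
      + zS S                                              ≡⟨ cong +_ (zS-∷ S s₁ rest elems≡) ⟩
      solutions ((y ∷ []) ∷ map C rest) fz                ≡⟨ ΠΣζ≋solutions ((y ∷ []) ∷ map C rest) fz ⟨
      (ΣC (map ζ^ (y ∷ [])) ⊛ ΠC (map (λ L → ΣC (map ζ^ L)) (map C rest))) fz
                                                          ≡⟨ cong (λ l → (ΣC (map ζ^ (y ∷ [])) ⊛ ΠC l) fz)
                                                                  (sym (map-∘ {g = λ L → ΣC (map ζ^ L)} {f = C} rest)) ⟩
      (ΣC (map ζ^ (y ∷ [])) ⊛ Rest) fz                    ≡⟨ ΣCζ-conv (y ∷ []) Rest fz ⟩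
      Rest (fz ⊟ R y) ℤ.+ + 0                             ≡⟨ ℤP.+-identityʳ _ ⟩
      Rest (fz ⊟ R y)                                     ∎
      where
      open ≡-Reasoning
      open TupleCount p' g d m using (solutions; ΠΣζ≋solutions)

    ηS-at-0 : W fz ≡ + m ℤ.* + zS S
    ηS-at-0 = trans W-at-0 (cong (+ m ℤ.*_) (sym zS≡Rest))

module Proposition9 (p' g d' m k' e : ℕ) (pr : Prime (suc p'))
            (g^p'≡1 : (g ℕ.^ p') ℕ.% suc p' ≡ 1)
            (order : ∀ j → 1 ℕ.≤ j → j ℕ.< p' → (g ℕ.^ j) ℕ.% suc p' ≢ 1)
            (md≡p' : m ℕ.* suc d' ≡ p') (S : Subset (suc d'))
            (|S|≡ : ∣ S ∣ ≡ suc k') (stab≡ : stabOrder S ≡ e) where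
  open Residues p' using (_~_)
  open PrimitiveRoot p' pr g g^p'≡1 order
  open import Data.Nat using (_*_; _^_)
  import Data.Nat.Properties as ℕP
  import Data.Integer as ℤ
  open ℤ using (ℤ; +_; _+_; _-_)
  import Data.Integer.Properties as ℤP
  open import Data.Integer.Tactic.RingSolver using (solve-∀)
  open import Data.Fin using (Fin; toℕ) renaming (zero to fz; suc to fs)
  open import Data.List using (_∷_; map; filter; length; allFin)
  open import Data.List.Properties using (map-∘; length-map)
  open import Data.Fin.Subset.Properties using (_∈?_)
  open import Data.Product using (∃₂; _,_)
  open import Relation.Binary.PropositionalEquality
  open Sums using (sum-cong-≗; sum-const)
  open import Defs

  g^md~1 : g ^ (m * suc d') ~ 1
  g^md~1 = subst (λ t → g ^ t ~ 1) (sym md≡p') g^p'~1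

  open OrbitSum p' g d' m g^-unit g^md~1 S
  open Multiplicity (_≟S_ {d}) using (Σ-uniform-multiplicity)

  P Z N K : ℤ
  P = + p'
  Z = + zS S
  N = V (R 1)
  K = + (m ^ k')

  -- each translate of S occurs e = |Stab(S)| times among the d translates
  orbit-sum≋V : (+ e) · ΣC (map ηS (orbit S)) ≋ V
  orbit-sum≋V i = begin
    + e ℤ.* ΣC (map ηS (orbit S)) i                  ≡⟨ cong (+ e ℤ.*_) (ΣC-ηS-at (orbit S)) ⟩
    + e ℤ.* sumℤ (map (λ T → ηS T i) (orbit S))      ≡⟨ Σ-uniform-multiplicity e (λ T → ηS T i) (translates S) multiplicity ⟨
    sumℤ (map (λ T → ηS T i) (translates S))         ≡⟨ ΣC-ηS-at (translates S) ⟨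
    ΣC (map ηS (translates S)) i                     ≡⟨ translates-sum i ⟩
    V i                                              ∎
    where
    open ≡-Reasoning
    open Translation d' using (translates; translate-multiplicity)
    ΣC-ηS-at : ∀ Ts → ΣC (map ηS Ts) i ≡ sumℤ (map (λ T → ηS T i) Ts)
    ΣC-ηS-at Ts = trans (ΣC-at (map ηS Ts) i) (cong sumℤ (sym (map-∘ {g = λ T → T i} {f = ηS} Ts)))
    multiplicity = λ T T∈ → trans (translate-multiplicity S T T∈) stab≡

  -- V is constant off 0, since the nonzero residues are the powers of g
  V-off-0 : ∀ j → V (fs j) ≡ N
  V-off-0 j with powers-cover (fs j) (λ ())
  ... | i , g^i≡ = trans (cong V (sym g^i≡)) (V-power i)

  |elems| : length (elems S) ≡ suc k'
  |elems| = trans (length-map toℕ (filter (_∈? S) (allFin d))) (trans (Counting.length-elements S) |S|≡)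

  first-element : ∃₂ λ s₁ rest → elems S ≡ s₁ ∷ rest
  first-element with elems S | |elems|
  ... | s₁ ∷ rest | _ = s₁ , rest , refl

  d*m≡P : + d ℤ.* + m ≡ P
  d*m≡P = trans (sym (ℤP.pos-* d m)) (cong +_ (trans (ℕP.*-comm d m) md≡p'))

  V0≡PZ : V fz ≡ P ℤ.* Z
  V0≡PZ with first-element
  ... | s₁ , rest , elems≡ = begin
    V fz                      ≡⟨ V-at-0 ⟩
    + d ℤ.* W fz              ≡⟨ cong (+ d ℤ.*_) (FirstElement.ηS-at-0 s₁ rest elems≡) ⟩
    + d ℤ.* (+ m ℤ.* Z)       ≡⟨ ℤP.*-assoc (+ d) (+ m) Z ⟨
    + d ℤ.* + m ℤ.* Z         ≡⟨ cong (ℤ._* Z) d*m≡P ⟩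
    P ℤ.* Z                   ∎
    where open ≡-Reasoning

  -- ε(V) computed from ε(η_S) = m^k …
  εV≡PK : ε V ≡ P ℤ.* K
  εV≡PK = begin
    ε V                       ≡⟨ ε-V ⟩
    + d ℤ.* ε W               ≡⟨ cong (+ d ℤ.*_) (trans (ε-Πη (elems S)) (cong (λ l → + (m ^ l)) |elems|)) ⟩
    + d ℤ.* + (m * m ^ k')    ≡⟨ cong (+ d ℤ.*_) (ℤP.pos-* m (m ^ k')) ⟩
    + d ℤ.* (+ m ℤ.* K)       ≡⟨ ℤP.*-assoc (+ d) (+ m) K ⟨
    + d ℤ.* + m ℤ.* K         ≡⟨ cong (ℤ._* K) d*m≡P ⟩
    P ℤ.* K                   ∎
    where open ≡-Reasoning

  -- … and from the coefficients of V
  εV≡PZ+PN : ε V ≡ P ℤ.* Z + P ℤ.* N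
  εV≡PZ+PN = cong₂ _+_ V0≡PZ (trans (sum-cong-≗ V-off-0) (sum-const p' N))

  z+N≡K : Z + N ≡ K
  z+N≡K = ℤP.*-cancelˡ-≡ P (Z + N) K {{nonZero 1≤p'}} (begin
    P ℤ.* (Z + N)          ≡⟨ ℤP.*-distribˡ-+ P Z N ⟩
    P ℤ.* Z + P ℤ.* N      ≡⟨ εV≡PZ+PN ⟨
    ε V                    ≡⟨ εV≡PK ⟩
    P ℤ.* K                ∎)
    where
    open ≡-Reasoning
    nonZero : ∀ {q} → 1 ℕ.≤ q → ℤ.NonZero (+ q)
    nonZero {suc q} _ = _

  -- the ring identity behind the value at 0, given z + N = m^k'
  rearrange : ∀ P Z N → P ℤ.* Z ≡ (Z + P ℤ.* Z) - (Z + N) + N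
  rearrange = solve-∀

  theorem : (+ e) · ΣC (map ηS (orbit S)) ≈ int (+ (n * zS S) - + (m ^ k'))
  theorem = N , coefficient
    where
    open ≡-Reasoning
    coefficient : ∀ i → ((+ e) · ΣC (map ηS (orbit S))) i ≡ int (+ (n * zS S) - + (m ^ k')) i + N
    coefficient fz = begin
      ((+ e) · ΣC (map ηS (orbit S))) fz      ≡⟨ orbit-sum≋V fz ⟩
      V fz                                    ≡⟨ V0≡PZ ⟩
      P ℤ.* Z                                 ≡⟨ rearrange P Z N ⟩
      (Z + P ℤ.* Z) - (Z + N) + N             ≡⟨ cong₂ (λ a b → a - b + N) (sym n*z) z+N≡K ⟩
      + (n * zS S) - K + N                    ∎
      where
      n*z : + (n * zS S) ≡ Z + P ℤ.* Z
      n*z = trans (ℤP.pos-+ (zS S) (p' * zS S)) (cong (λ w → Z + w) (ℤP.pos-* p' (zS S)))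
    coefficient (fs j) = trans (orbit-sum≋V (fs j)) (trans (V-off-0 j) (sym (ℤP.+-identityˡ N)))

open import Defs
open import Data.Nat using (_∸_; _^_; _≤_; _*_)
open import Data.Nat.Primality using (prime⇒nonZero; ¬prime[0])
open import Data.Nat.Divisibility using (_∣_)
open import Data.Nat.GCD using (gcd)
open import Data.Integer using (+_; _-_)
open import Data.List using (map)
open import Data.Product using (_,_)
open import Relation.Nullary using (contradiction)

-- The degenerate cases p = 0, d = 0, k = 0 contradict the hypotheses.
proposition9 : (p g d m k e : ℕ) → (pr : Prime p) → p ≢ 2 → IsPrimitiveRoot p g
    → 1 ≤ d → m * d ≡ p ∸ 1 → 1 ≤ k → k ≤ d → e ∣ gcd d k
    → (S : Subset d) → InM e d k S
    → let open Periods p g d m {{prime⇒nonZero pr}} in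
    (+ e) · ΣC (map ηS (orbit S)) ≈ int (+ (p * zS S) - + (m ^ (k ∸ 1)))
proposition9 zero _ _ _ _ _ pr _ _ _ _ _ _ _ _ _ = contradiction pr ¬prime[0]
proposition9 (suc p') g zero m k e pr _ _ () _ _ _ _ _ _
proposition9 (suc p') g (suc d') m zero e pr _ _ _ _ () _ _ _ _
proposition9 (suc p') g (suc d') m (suc k') e pr _ (_ , g^p'≡1 , order) _ md≡p' _ _ _ S (|S|≡ , stab≡) =
  Proposition9.theorem p' g d' m k' e pr g^p'≡1 order md≡p' S |S|≡ stab≡
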